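{- Let $H$ be a hypergraph of rank $3$ and let $u,v$ be vertices of $H$ such that $u\text{ - }\mathcal{F}_{H^{ -v}}$ and $v\text{ - }\mathcal{F}_{H^{ -u}}$ are empty. If Waiter has a winning strategy in the Client-Waiter game on $H$, then Waiter has a winning strategy on $H$ which starts by offering the pair $\{u,v\}$.
   Context: Standing assumption: all hypergraphs are clutters (no edge is contained in another edge). Client-Waiter game: while at least two vertices are unclaimed, Waiter offers two unclaimed vertices, Client claims one and Waiter the other; if the number of vertices is odd the last vertex goes to Client; Client wins iff he claims all vertices of some edge, otherwise Waiter wins. For $G=(W,F)$ and vertex $x$: $G^{ -x}=(W\setminus\{x\},\{e\in F: x\notin e\})$. Paths/cycles: an $ab$-path is a sequence of edges $(e_1,\dots,e_t)$ with $a\in e_1$, $b\in e_t$, $e_i\cap e_{i+1}\ne\emptyset$; an $a$-path is an $ab$-path for some $b$; an $a$-cycle is an $aa$-path of length $\ge2$. A path is linear if consecutive edges meet in exactly one vertex; an $a$-cycle of length $\ge3$ is linear if linear as an $aa$-path and its first and last edges meet exactly in $\{a\}$; an $a$-cycle $(e_1,e_2)$ is linear if $|e_1\cap e_2|=2$. An $ab$-path is simple if $a$ is only in $e_1$, $b$ only in $e_t$, and $e_i\cap e_j\ne\emptyset$ implies $|i-j|\le1$; an $a$-cycle $(e_1,\dots,e_t)$ is simple if $e_i\cap e_j\neq\emptyset$ implies $|i-j|\le1$ or $\{i,j\}=\{1,t\}$. 3-uniform: all edges have size $3$. A $u$-snake is a $u$-path $(e_1,\dots,e_t)$, $t\ge1$,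 with $|e_i|=3$ for $i<t$ and $|e_t|\le 2$. For $a\ne b$, an $ab$-tadpole is $(e_1,\dots,e_s,f_1,\dots,f_t)$ with $a$ only in $e_1$; $b$ only in $e_s,f_1,f_t$; $(e_1,\dots,e_s)$ a 3-uniform simple linear $ab$-path; $(f_1,\dots,f_t)$ a 3-uniform simple linear $b$-cycle; $b$ the only vertex common to both. An $aa$-tadpole is a 3-uniform simple linear $a$-cycle; a $u$-tadpole is a $ub$-tadpole for some $b$. For a hypergraph $G$, $u\text{ - }\mathcal{F}_G$ is the family of subhypergraphs of $G$ which are $u$-snakes or $u$-tadpoles. -}

module Defs where

open import Data.Nat using (ℕ; zero; suc; _≤_; _≥_)
open import Data.Fin using (Fin; toℕ; inject₁; fromℕ)
import Data.Fin as F
open import Data.Fin.Subset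
  using (Subset; _∈_; _∉_; _⊆_; _∩_; _∪_; _─_; ⁅_⁆; ∣_∣; Nonempty)
  renaming (⊥ to ∅)
open import Data.List using (List; filter)
open import Data.Fin.Subset.Properties using (_∈?_)
open import Relation.Nullary using (¬?)
import Data.List.Membership.Propositional as LM
open import Data.Product using (Σ; ∃; _×_)
open import Data.Sum using (_⊎_)
open import Data.Empty renaming (⊥ to False)
open import Relation.Nullary using (¬_)
open import Relation.Binary.PropositionalEquality using (_≡_; _≢_)

-- Hypergraphs on the ambient vertex type Fin n.
-- A hypergraph is a vertex set W ⊆ Fin n together with a finite list of
-- edges (each a subset of Fin n); the edge *set* is the set of list members.

record Hypergraph (n : ℕ) : Set where
  constructor hyp
  field
    vertices : Subset n
    edges    : List (Subset n)
open Hypergraph public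

_∈E_ : ∀ {n} → Subset n → Hypergraph n → Set
e ∈E G = e LM.∈ edges G

WellFormed : ∀ {n} → Hypergraph n → Set
WellFormed G = ∀ e → e ∈E G → e ⊆ vertices G

Clutter : ∀ {n} → Hypergraph n → Set
Clutter G = ∀ e f → e ∈E G → f ∈E G → e ⊆ f → e ≡ f

Rank3 : ∀ {n} → Hypergraph n → Set
Rank3 G = (∀ e → e ∈E G → ∣ e ∣ ≤ 3) × (Σ (Subset _) λ e → e ∈E G × ∣ e ∣ ≡ 3)

removeVertex : ∀ {n} → Hypergraph n → Fin n → Hypergraph n
removeVertex (hyp W F) x = hyp (W ─ ⁅ x ⁆) (filter (λ e → ¬? (x ∈? e)) F)

-- Sequences of edges (e₁,…,e_t) with t = suc k, indexed by Fin (suc k);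
-- index zero is e₁ and index fromℕ k is e_t.

EdgeSeq : ℕ → ℕ → Set
EdgeSeq n k = Fin (suc k) → Subset n

module _ {n : ℕ} where

  InG : ∀ {k} → Hypergraph n → EdgeSeq n k → Set
  InG G e = ∀ i → e i ∈E G

  Consecutive : ∀ {k} → EdgeSeq n k → Set
  Consecutive {k} e = ∀ (i : Fin k) → Nonempty (e (inject₁ i) ∩ e (F.suc i))

  IsPath : ∀ {k} → Fin n → Fin n → EdgeSeq n k → Set
  IsPath {k} a b e = a ∈ e F.zero × b ∈ e (fromℕ k) × Consecutive e

  IsAPath : ∀ {k} → Fin n → EdgeSeq n k → Set
  IsAPath a e = Σ (Fin n) λ b → IsPath a b e

  IsCycle : ∀ {k} → Fin n → EdgeSeq n k → Set
  IsCycle {k} a e = IsPath a a e × k ≥ 1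

  LinearConsec : ∀ {k} → EdgeSeq n k → Set
  LinearConsec {k} e = ∀ (i : Fin k) → ∣ e (inject₁ i) ∩ e (F.suc i) ∣ ≡ 1

  -- linear a-cycle (assuming it is an a-cycle)
  LinearCycle : ∀ {k} → Fin n → EdgeSeq n k → Set
  LinearCycle {k} a e =
      (k ≥ 2 × LinearConsec e × (e F.zero ∩ e (fromℕ k)) ≡ ⁅ a ⁆)
    ⊎ (k ≡ 1 × ∣ e F.zero ∩ e (fromℕ k) ∣ ≡ 2)

  Near : ∀ {m} → Fin m → Fin m → Set
  Near i j = toℕ i ≤ suc (toℕ j) × toℕ j ≤ suc (toℕ i)

  -- simple ab-path (conditions beyond being an ab-path)
  SimplePath : ∀ {k} → Fin n → Fin n → EdgeSeq n k → Set
  SimplePath {k} a b e =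
      (∀ i → a ∈ e i → i ≡ F.zero)
    × (∀ i → b ∈ e i → i ≡ fromℕ k)
    × (∀ i j → Nonempty (e i ∩ e j) → Near i j)

  -- simple cycle (conditions beyond being a cycle)
  SimpleCycle : ∀ {k} → EdgeSeq n k → Set
  SimpleCycle {k} e =
    ∀ i j → Nonempty (e i ∩ e j) →
      Near i j ⊎ (i ≡ F.zero × j ≡ fromℕ k) ⊎ (i ≡ fromℕ k × j ≡ F.zero)

  Uniform3 : ∀ {k} → EdgeSeq n k → Set
  Uniform3 e = ∀ i → ∣ e i ∣ ≡ 3

  IsSnake : ∀ {k} → Fin n → EdgeSeq n k → Set
  IsSnake {k} u e =
    IsAPath u e × (∀ (i : Fin k) → ∣ e (inject₁ i) ∣ ≡ 3) × ∣ e (fromℕ k) ∣ ≤ 2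

  SimpleLinear3Cycle : ∀ {k} → Fin n → EdgeSeq n k → Set
  SimpleLinear3Cycle a e =
    Uniform3 e × IsCycle a e × LinearCycle a e × SimpleCycle e

  IsABTadpole : ∀ {k m} → Fin n → Fin n → EdgeSeq n k → EdgeSeq n m → Set
  IsABTadpole {k} {m} a b e f =
      a ≢ b
    × (∀ i → a ∈ e i → i ≡ F.zero) × (∀ j → a ∉ f j)
    × (∀ i → b ∈ e i → i ≡ fromℕ k)
    × (∀ j → b ∈ f j → j ≡ F.zero ⊎ j ≡ fromℕ m)
    × (Uniform3 e × IsPath a b e × SimplePath a b e × LinearConsec e)
    × SimpleLinear3Cycle b f
    × (∀ x i j → x ∈ e i → x ∈ f j → x ≡ b)

  IsAATadpole : ∀ {k} → Fin n → EdgeSeq n k → Set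
  IsAATadpole a e = SimpleLinear3Cycle a e

  data FamilyMember (G : Hypergraph n) (u : Fin n) : Set where
    snake   : ∀ k (e : EdgeSeq n k) → InG G e → IsSnake u e → FamilyMember G u
    tadpole : ∀ b k m (e : EdgeSeq n k) (f : EdgeSeq n m) →
              InG G e → InG G f → IsABTadpole u b e f → FamilyMember G u
    cycle   : ∀ k (e : EdgeSeq n k) → InG G e → IsAATadpole u e → FamilyMember G u

  FamilyEmpty : Hypergraph n → Fin n → Set
  FamilyEmpty G u = ¬ FamilyMember G u

  -- Client-Waiter game on G.  State: U = unclaimed vertices,
  -- C = vertices claimed by Client.  WaiterWins G U C : Waiter has a
  -- winning strategy from this state.
  data WaiterWins (G : Hypergraph n) : Subset n → Subset n → Set where
    end0  : ∀ {U C} → ∣ U ∣ ≡ 0 → (∀ e → e ∈E G → ¬ (e ⊆ C)) → WaiterWins G U C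
    -- one vertex left: it goes to Client
    end1  : ∀ {U C} → ∣ U ∣ ≡ 1 → (∀ e → e ∈E G → ¬ (e ⊆ (C ∪ U))) → WaiterWins G U C
    offer : ∀ {U C} (a b : Fin n) → a ∈ U → b ∈ U → a ≢ b →
            WaiterWins G (U ─ (⁅ a ⁆ ∪ ⁅ b ⁆)) (C ∪ ⁅ a ⁆) →
            WaiterWins G (U ─ (⁅ a ⁆ ∪ ⁅ b ⁆)) (C ∪ ⁅ b ⁆) →
            WaiterWins G U C

  WaiterWinsGame : Hypergraph n → Set
  WaiterWinsGame G = WaiterWins G (vertices G) ∅

  WaiterWinsStartingWith : Hypergraph n → Fin n → Fin n → Set
  WaiterWinsStartingWith G u v =
      u ∈ vertices G × v ∈ vertices G × u ≢ v
    × WaiterWins G (vertices G ─ (⁅ u ⁆ ∪ ⁅ v ⁆)) (∅ ∪ ⁅ u ⁆)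
    × WaiterWins G (vertices G ─ (⁅ u ⁆ ∪ ⁅ v ⁆)) (∅ ∪ ⁅ v ⁆)

-- Once Client has taken u from the first offer {u, v}, Waiter owns v, so only edges of
-- H^{-v} can still be completed.  Waiter then keeps a path u = x₀, x₁, …, x_D of Client
-- vertices with edges t_i = {x_i, x_{i+1}, b_i} of H^{-v} in which b_i is hers.  If
-- some edge g without Waiter vertices contains x_D, it has exactly two more vertices,
-- both unclaimed; Waiter offers them and Client's choice extends the path.  Otherwise
-- she backtracks.  Every edge without Waiter vertices that meets Client's set meets it
-- in a single vertex of the current path and has size 3: an edge through a new path
-- vertex of size at most 2 would end a u-snake, and one also through an earlier path
-- vertex x_j would close a u-cycle (j = 0) or a u-tadpole, all excluded by
-- u-𝓕_{H^{-v}} = ∅.  Once the path is exhausted, Client's vertices lie in no edge he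
-- can still complete, and Waiter plays her original winning strategy, regarding all
-- vertices claimed so far as her own.  The branch in which Client takes v is symmetric.

module Submission where

open import Defs
open import Data.Fin using (Fin)
open import Data.Fin.Subset using (_∈_)
open import Relation.Binary.PropositionalEquality using (_≢_)

open import Data.Nat using (ℕ; zero; suc; _+_; _∸_; _≤_; _<_; z≤n; s≤s; _<?_)
import Data.Nat.Properties as ℕ
open import Data.Fin as Fin using (toℕ; fromℕ; inject₁; _≟_)
open import Data.Fin.Properties using (toℕ-injective; toℕ-fromℕ; toℕ-inject₁; toℕ<n; toℕ≤pred[n])
open import Data.Fin.Subset
  using (Subset; _∉_; _⊆_; _∩_; _∪_; _─_; _-_; ⁅_⁆; ∣_∣; Nonempty; Empty; inside; outside)
  renaming (⊥ to ∅)
open import Data.Fin.Subset.Properties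
  using (_∈?_; _⊆?_; x∈p∪q⁺; x∈p∪q⁻; x∈p∩q⁺; x∈p∩q⁻; x∈⁅x⁆; x∈⁅y⁆⇒x≡y; x≢y⇒x∉⁅y⁆; x∈p∧x∉q⇒x∈p─q
        ; x∈p∧x≢y⇒x∈p-y; Empty-unique; nonempty?; ∣⊥∣≡0; p─⊥≡p; p─q─r≡p─q∪r; p─q─r≡p─r─q
        ; ⊆-refl; ⊆-antisym; ∪-assoc; ∪-comm; ∪-identityˡ; ∪-identityʳ)
open import Data.Vec using (_∷_; here; there)
open import Data.List.Membership.Propositional using (find; lose)
open import Data.List.Membership.Propositional.Properties using (∈-filter⁺)
open import Data.List.Relation.Unary.Any using (any?)
open import Data.Product using (∃; _×_; _,_; proj₁; proj₂)
open import Data.Sum using (_⊎_; inj₁; inj₂; [_,_]′)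
open import Data.Empty using (⊥-elim)
open import Function using (_∘_)
open import Relation.Nullary using (¬_; yes; no; contradiction; ¬?)
open import Relation.Nullary.Decidable using (_×-dec_)
open import Relation.Binary.PropositionalEquality hiding (J)

private variable
  n k : ℕ
  x y : Fin n
  p q : Subset n

-- Finite subsets

∈∪ˡ : x ∈ p → x ∈ p ∪ q
∈∪ˡ x∈p = x∈p∪q⁺ (inj₁ x∈p)

∈∪ʳ : x ∈ q → x ∈ p ∪ q
∈∪ʳ x∈q = x∈p∪q⁺ (inj₂ x∈q)

x∈p─q⁻ : ∀ (p q : Subset n) → x ∈ p ─ q → x ∈ p × x ∉ q
x∈p─q⁻ (inside ∷ p) (outside ∷ q) here = here , λ ()
x∈p─q⁻ {x = Fin.zero} (inside ∷ p) (inside ∷ q) ()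
x∈p─q⁻ {x = Fin.zero} (outside ∷ p) (inside ∷ q) ()
x∈p─q⁻ {x = Fin.zero} (outside ∷ p) (outside ∷ q) ()
x∈p─q⁻ (_ ∷ p) (_ ∷ q) (there x∈p─q) =
  let x∈p , x∉q = x∈p─q⁻ p q x∈p─q in there x∈p , λ { (there x∈q) → x∉q x∈q }

suc∣p-x∣≡∣p∣ : x ∈ p → suc ∣ p - x ∣ ≡ ∣ p ∣
suc∣p-x∣≡∣p∣ {p = inside ∷ p} here = cong (λ r → suc ∣ r ∣) (p─⊥≡p p)
suc∣p-x∣≡∣p∣ {p = inside ∷ p} (there x∈p) = cong suc (suc∣p-x∣≡∣p∣ x∈p)
suc∣p-x∣≡∣p∣ {p = outside ∷ p} (there x∈p) = suc∣p-x∣≡∣p∣ x∈p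

x≡y⇒x∈⁅y⁆ : x ≡ y → x ∈ ⁅ y ⁆
x≡y⇒x∈⁅y⁆ {x = x} refl = x∈⁅x⁆ x

y∈p⇒⁅y⁆⊆p : y ∈ p → ⁅ y ⁆ ⊆ p
y∈p⇒⁅y⁆⊆p {y = y} {p = p} y∈p x∈⁅y⁆ = subst (_∈ p) (sym (x∈⁅y⁆⇒x≡y y x∈⁅y⁆)) y∈p

∣p-x∣≡pred : x ∈ p → ∣ p ∣ ≡ suc k → ∣ p - x ∣ ≡ k
∣p-x∣≡pred x∈p ∣p∣≡1+k = ℕ.suc-injective (trans (suc∣p-x∣≡∣p∣ x∈p) ∣p∣≡1+k)

∣p∣≡0⇒x∉p : ∣ p ∣ ≡ 0 → x ∉ p
∣p∣≡0⇒x∉p ∣p∣≡0 x∈p = ℕ.1+n≢0 (trans (suc∣p-x∣≡∣p∣ x∈p) ∣p∣≡0)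

Empty⇒∣p∣≡0 : ∀ {n} {p : Subset n} → Empty p → ∣ p ∣ ≡ 0
Empty⇒∣p∣≡0 {n} empty = trans (cong ∣_∣ (Empty-unique empty)) (∣⊥∣≡0 n)

∣p∣≡suc⇒Nonempty : ∣ p ∣ ≡ suc k → Nonempty p
∣p∣≡suc⇒Nonempty {p = p} ∣p∣≡suc with nonempty? p
... | yes nonempty = nonempty
... | no empty = contradiction (trans (sym ∣p∣≡suc) (Empty⇒∣p∣≡0 empty)) ℕ.1+n≢0

∣p∣≡1⇒singleton : ∣ p ∣ ≡ 1 → ∃ λ y → y ∈ p × (∀ {z} → z ∈ p → z ≡ y)
∣p∣≡1⇒singleton {p = p} ∣p∣≡1 with ∣p∣≡suc⇒Nonempty ∣p∣≡1
... | y , y∈p = y , y∈p , unique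
  where
  unique : ∀ {z} → z ∈ p → z ≡ y
  unique {z} z∈p with z ≟ y
  ... | yes z≡y = z≡y
  ... | no z≢y = contradiction (x∈p∧x≢y⇒x∈p-y z∈p z≢y)
                   (∣p∣≡0⇒x∉p (∣p-x∣≡pred y∈p ∣p∣≡1))

singleton⇒∣p∣≡1 : y ∈ p → (∀ {z} → z ∈ p → z ≡ y) → ∣ p ∣ ≡ 1
singleton⇒∣p∣≡1 {p = p} y∈p unique =
  trans (sym (suc∣p-x∣≡∣p∣ y∈p)) (cong suc (Empty⇒∣p∣≡0 λ (z , z∈p-y) →
    let z∈p , z∉⁅y⁆ = x∈p─q⁻ p _ z∈p-y in z∉⁅y⁆ (x≡y⇒x∈⁅y⁆ (unique z∈p))))

pair⇒∣p∣≡2 : x ≢ y → x ∈ p → y ∈ p → (∀ {z} → z ∈ p → z ≡ x ⊎ z ≡ y) → ∣ p ∣ ≡ 2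
pair⇒∣p∣≡2 {x = x} {y = y} {p = p} x≢y x∈p y∈p cover =
  trans (sym (suc∣p-x∣≡∣p∣ x∈p))
        (cong suc (singleton⇒∣p∣≡1 (x∈p∧x≢y⇒x∈p-y y∈p (x≢y ∘ sym)) is-y))
  where
  is-y : ∀ {z} → z ∈ p - x → z ≡ y
  is-y z∈p-x with x∈p─q⁻ p _ z∈p-x
  ... | z∈p , z∉⁅x⁆ with cover z∈p
  ...   | inj₁ z≡x = contradiction (x≡y⇒x∈⁅y⁆ z≡x) z∉⁅x⁆
  ...   | inj₂ z≡y = z≡y

record Triple (g : Subset n) (c : Fin n) : Set where
  field
    other₁ other₂ : Fin n
    other₁≢other₂ : other₁ ≢ other₂
    other₁≢c : other₁ ≢ c
    other₂≢c : other₂ ≢ c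
    other₁∈g : other₁ ∈ g
    other₂∈g : other₂ ∈ g
    cover : ∀ {z} → z ∈ g → z ≡ c ⊎ z ≡ other₁ ⊎ z ≡ other₂

∣p∣≡3⇒Triple : ∣ p ∣ ≡ 3 → x ∈ p → Triple p x
∣p∣≡3⇒Triple {p = p} {x = c} ∣p∣≡3 c∈p
  with a , a∈p-c ← ∣p∣≡suc⇒Nonempty (∣p-x∣≡pred c∈p ∣p∣≡3)
  with b , b∈p-c-a , only-b ← ∣p∣≡1⇒singleton (∣p-x∣≡pred a∈p-c (∣p-x∣≡pred c∈p ∣p∣≡3))
  with a∈p , a∉⁅c⁆ ← x∈p─q⁻ p _ a∈p-c
  with b∈p-c , b∉⁅a⁆ ← x∈p─q⁻ (p - c) _ b∈p-c-a
  with b∈p , b∉⁅c⁆ ← x∈p─q⁻ p _ b∈p-c = record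
  { other₁ = a ; other₂ = b
  ; other₁≢other₂ = b∉⁅a⁆ ∘ x≡y⇒x∈⁅y⁆ ∘ sym
  ; other₁≢c = a∉⁅c⁆ ∘ x≡y⇒x∈⁅y⁆
  ; other₂≢c = b∉⁅c⁆ ∘ x≡y⇒x∈⁅y⁆
  ; other₁∈g = a∈p ; other₂∈g = b∈p ; cover = cover }
  where
  cover : ∀ {z} → z ∈ p → z ≡ c ⊎ z ≡ a ⊎ z ≡ b
  cover {z} z∈p with z ≟ c | z ≟ a
  ... | yes z≡c | _ = inj₁ z≡c
  ... | no _ | yes z≡a = inj₂ (inj₁ z≡a)
  ... | no z≢c | no z≢a =
    inj₂ (inj₂ (only-b (x∈p∧x≢y⇒x∈p-y (x∈p∧x≢y⇒x∈p-y z∈p z≢c) z≢a)))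

2+∣p─⁅x⁆∪⁅y⁆∣≡∣p∣ : x ∈ p → y ∈ p → x ≢ y → suc (suc ∣ p ─ (⁅ x ⁆ ∪ ⁅ y ⁆) ∣) ≡ ∣ p ∣
2+∣p─⁅x⁆∪⁅y⁆∣≡∣p∣ {x = x} {p = p} {y = y} x∈p y∈p x≢y = begin
  suc (suc ∣ p ─ (⁅ x ⁆ ∪ ⁅ y ⁆) ∣) ≡⟨ cong (λ r → suc (suc ∣ r ∣)) (sym (p─q─r≡p─q∪r p ⁅ x ⁆ ⁅ y ⁆)) ⟩
  suc (suc ∣ p - x - y ∣)           ≡⟨ cong suc (suc∣p-x∣≡∣p∣ (x∈p∧x≢y⇒x∈p-y y∈p (x≢y ∘ sym))) ⟩
  suc ∣ p - x ∣                     ≡⟨ suc∣p-x∣≡∣p∣ x∈p ⟩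
  ∣ p ∣                             ∎
  where open ≡-Reasoning

p∪q∪r≡p∪r∪q : ∀ (p q r : Subset n) → (p ∪ q) ∪ r ≡ (p ∪ r) ∪ q
p∪q∪r≡p∪r∪q p q r = begin
  (p ∪ q) ∪ r ≡⟨ ∪-assoc p q r ⟩
  p ∪ (q ∪ r) ≡⟨ cong (p ∪_) (∪-comm q r) ⟩
  p ∪ (r ∪ q) ≡⟨ ∪-assoc p r q ⟨
  (p ∪ r) ∪ q ∎
  where open ≡-Reasoning

x∉q⇒[p─q]∪⁅x⁆≡[p∪⁅x⁆]─q : x ∉ q → (p ─ q) ∪ ⁅ x ⁆ ≡ (p ∪ ⁅ x ⁆) ─ q
x∉q⇒[p─q]∪⁅x⁆≡[p∪⁅x⁆]─q {x = x} {q = q} {p = p} x∉q = ⊆-antisym to from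
  where
  to : (p ─ q) ∪ ⁅ x ⁆ ⊆ (p ∪ ⁅ x ⁆) ─ q
  to z∈ with x∈p∪q⁻ (p ─ q) _ z∈
  ... | inj₁ z∈p─q = let z∈p , z∉q = x∈p─q⁻ p q z∈p─q in x∈p∧x∉q⇒x∈p─q (∈∪ˡ z∈p) z∉q
  ... | inj₂ z∈⁅x⁆ = x∈p∧x∉q⇒x∈p─q (∈∪ʳ z∈⁅x⁆) (subst (_∉ q) (sym (x∈⁅y⁆⇒x≡y x z∈⁅x⁆)) x∉q)
  from : (p ∪ ⁅ x ⁆) ─ q ⊆ (p ─ q) ∪ ⁅ x ⁆
  from z∈ with x∈p─q⁻ (p ∪ ⁅ x ⁆) q z∈
  ... | z∈p∪x , z∉q = [ (λ z∈p → ∈∪ˡ (x∈p∧x∉q⇒x∈p─q z∈p z∉q)) , ∈∪ʳ ]′ (x∈p∪q⁻ p _ z∈p∪x)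

[p─⁅x⁆∪⁅y⁆]∪⁅y⁆≡p-x : y ∈ p → x ≢ y → (p ─ (⁅ x ⁆ ∪ ⁅ y ⁆)) ∪ ⁅ y ⁆ ≡ p - x
[p─⁅x⁆∪⁅y⁆]∪⁅y⁆≡p-x {y = y} {p = p} {x = x} y∈p x≢y = ⊆-antisym to from
  where
  to : (p ─ (⁅ x ⁆ ∪ ⁅ y ⁆)) ∪ ⁅ y ⁆ ⊆ p - x
  to z∈ with x∈p∪q⁻ (p ─ (⁅ x ⁆ ∪ ⁅ y ⁆)) _ z∈
  ... | inj₁ z∈p─xy = let z∈p , z∉xy = x∈p─q⁻ p _ z∈p─xy in x∈p∧x∉q⇒x∈p─q z∈p (z∉xy ∘ ∈∪ˡ)
  ... | inj₂ z∈⁅y⁆ with x∈⁅y⁆⇒x≡y y z∈⁅y⁆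
  ...   | refl = x∈p∧x≢y⇒x∈p-y y∈p (x≢y ∘ sym)
  from : p - x ⊆ (p ─ (⁅ x ⁆ ∪ ⁅ y ⁆)) ∪ ⁅ y ⁆
  from {z} z∈ with x∈p─q⁻ p ⁅ x ⁆ z∈ | z ≟ y
  ... | _ | yes z≡y = ∈∪ʳ (x≡y⇒x∈⁅y⁆ z≡y)
  ... | z∈p , z∉⁅x⁆ | no z≢y =
    ∈∪ˡ (x∈p∧x∉q⇒x∈p─q z∈p ([ z∉⁅x⁆ , x≢y⇒x∉⁅y⁆ z≢y ]′ ∘ x∈p∪q⁻ ⁅ x ⁆ ⁅ y ⁆))

-- Monotonicity of Waiter's wins

NoEdgeWithin : Hypergraph n → Subset n → Set
NoEdgeWithin G S = ∀ e → e ∈E G → ¬ e ⊆ S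

module _ {G : Hypergraph n} where

  NoEdgeWithin-⊆ : ∀ {S T} → S ⊆ T → NoEdgeWithin G T → NoEdgeWithin G S
  NoEdgeWithin-⊆ S⊆T none e e∈G e⊆S = none e e∈G (λ z∈e → S⊆T (e⊆S z∈e))

  WaiterWins-unclaim : ∀ {U C C′ b} → b ∉ U → C ∪ ⁅ b ⁆ ⊆ C′ →
                       WaiterWins G U C′ → WaiterWins G (U ∪ ⁅ b ⁆) C
  WaiterWins-unclaim {U} {C} {C′} {b} b∉U C∪b⊆C′ (end0 ∣U∣≡0 safe) =
    end1 (singleton⇒∣p∣≡1 {p = U ∪ ⁅ b ⁆} (∈∪ʳ {p = U} (x∈⁅x⁆ b)) only-b)
         (NoEdgeWithin-⊆ (λ z∈ → C∪b⊆C′ (⊆C∪b z∈)) safe)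
    where
    only-b : ∀ {z} → z ∈ U ∪ ⁅ b ⁆ → z ≡ b
    only-b z∈ = [ (λ z∈U → contradiction z∈U (∣p∣≡0⇒x∉p ∣U∣≡0)) , x∈⁅y⁆⇒x≡y b ]′ (x∈p∪q⁻ U _ z∈)
    ⊆C∪b : C ∪ (U ∪ ⁅ b ⁆) ⊆ C ∪ ⁅ b ⁆
    ⊆C∪b z∈ = [ ∈∪ˡ , (λ z∈U∪b → ∈∪ʳ (x≡y⇒x∈⁅y⁆ (only-b z∈U∪b))) ]′ (x∈p∪q⁻ C _ z∈)
  WaiterWins-unclaim {U} {C} {C′} {b} b∉U C∪b⊆C′ (end1 ∣U∣≡1 safe)
    with y , y∈U , only-y ← ∣p∣≡1⇒singleton ∣U∣≡1 =
    offer y b (∈∪ˡ {q = ⁅ b ⁆} y∈U) (∈∪ʳ {p = U} (x∈⁅x⁆ b)) (λ { refl → b∉U y∈U })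
      (end0 nothing-left (NoEdgeWithin-⊆ C∪y⊆ safe))
      (end0 nothing-left (NoEdgeWithin-⊆ (λ z∈ → ∈∪ˡ (C∪b⊆C′ z∈)) safe))
    where
    nothing-left : ∣ (U ∪ ⁅ b ⁆) ─ (⁅ y ⁆ ∪ ⁅ b ⁆) ∣ ≡ 0
    nothing-left = Empty⇒∣p∣≡0 λ (z , z∈) →
      let z∈U∪b , z∉yb = x∈p─q⁻ (U ∪ ⁅ b ⁆) _ z∈
      in [ (λ z∈U → z∉yb (∈∪ˡ (x≡y⇒x∈⁅y⁆ (only-y z∈U)))) , z∉yb ∘ ∈∪ʳ ]′ (x∈p∪q⁻ U _ z∈U∪b)
    C∪y⊆ : C ∪ ⁅ y ⁆ ⊆ C′ ∪ U
    C∪y⊆ z∈ = [ ∈∪ˡ ∘ C∪b⊆C′ ∘ ∈∪ˡ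
              , (λ z∈⁅y⁆ → ∈∪ʳ (y∈p⇒⁅y⁆⊆p y∈U z∈⁅y⁆)) ]′ (x∈p∪q⁻ C _ z∈)
  WaiterWins-unclaim {U} {C} {C′} {b} b∉U C∪b⊆C′ (offer a₁ a₂ a₁∈U a₂∈U a₁≢a₂ w₁ w₂) =
    offer a₁ a₂ (∈∪ˡ {q = ⁅ b ⁆} a₁∈U) (∈∪ˡ {q = ⁅ b ⁆} a₂∈U) a₁≢a₂ (branch w₁) (branch w₂)
    where
    b∉a₁a₂ : b ∉ ⁅ a₁ ⁆ ∪ ⁅ a₂ ⁆
    b∉a₁a₂ b∈ = [ (λ b∈a₁ → b∉U (y∈p⇒⁅y⁆⊆p a₁∈U b∈a₁))
                , (λ b∈a₂ → b∉U (y∈p⇒⁅y⁆⊆p a₂∈U b∈a₂)) ]′ (x∈p∪q⁻ ⁅ a₁ ⁆ _ b∈)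
    branch : ∀ {c} → WaiterWins G (U ─ (⁅ a₁ ⁆ ∪ ⁅ a₂ ⁆)) (C′ ∪ ⁅ c ⁆) →
             WaiterWins G ((U ∪ ⁅ b ⁆) ─ (⁅ a₁ ⁆ ∪ ⁅ a₂ ⁆)) (C ∪ ⁅ c ⁆)
    branch {c} w = subst (λ V → WaiterWins G V (C ∪ ⁅ c ⁆)) (x∉q⇒[p─q]∪⁅x⁆≡[p∪⁅x⁆]─q b∉a₁a₂)
      (WaiterWins-unclaim (b∉U ∘ proj₁ ∘ x∈p─q⁻ U _) C∪c∪b⊆ w)
      where
      C∪c∪b⊆ : (C ∪ ⁅ c ⁆) ∪ ⁅ b ⁆ ⊆ C′ ∪ ⁅ c ⁆
      C∪c∪b⊆ z∈ with x∈p∪q⁻ (C ∪ ⁅ b ⁆) _ (subst (_ ∈_) (p∪q∪r≡p∪r∪q C ⁅ c ⁆ ⁅ b ⁆) z∈)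
      ... | inj₁ z∈C∪b = ∈∪ˡ (C∪b⊆C′ z∈C∪b)
      ... | inj₂ z∈c = ∈∪ʳ z∈c

  WaiterWins-remove : ∀ {U C x} → x ∈ U → WaiterWins G U C → WaiterWins G (U - x) C
  WaiterWins-remove x∈U (end0 ∣U∣≡0 _) = contradiction x∈U (∣p∣≡0⇒x∉p ∣U∣≡0)
  WaiterWins-remove {U} {C} {x} x∈U (end1 ∣U∣≡1 safe)
    with y , y∈U , only-y ← ∣p∣≡1⇒singleton ∣U∣≡1 =
    end0 (Empty⇒∣p∣≡0 λ (z , z∈U-x) →
            let z∈U , z∉⁅x⁆ = x∈p─q⁻ U _ z∈U-x
            in z∉⁅x⁆ (x≡y⇒x∈⁅y⁆ (trans (only-y z∈U) (sym (only-y x∈U)))))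
         (NoEdgeWithin-⊆ ∈∪ˡ safe)
  WaiterWins-remove {U} {C} {x} x∈U (offer a b a∈U b∈U a≢b w₁ w₂) with x ≟ a | x ≟ b
  ... | yes refl | _ =
    subst (λ V → WaiterWins G V C) ([p─⁅x⁆∪⁅y⁆]∪⁅y⁆≡p-x b∈U a≢b)
      (WaiterWins-unclaim (λ b∈ → proj₂ (x∈p─q⁻ U _ b∈) (∈∪ʳ (x∈⁅x⁆ b))) ⊆-refl w₂)
  ... | no _ | yes refl =
    subst (λ V → WaiterWins G V C)
      (trans (cong (λ S → (U ─ S) ∪ ⁅ a ⁆) (∪-comm ⁅ a ⁆ ⁅ x ⁆)) ([p─⁅x⁆∪⁅y⁆]∪⁅y⁆≡p-x a∈U (a≢b ∘ sym)))
      (WaiterWins-unclaim (λ a∈ → proj₂ (x∈p─q⁻ U _ a∈) (∈∪ˡ (x∈⁅x⁆ a))) ⊆-refl w₁)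
  ... | no x≢a | no x≢b =
    offer a b (x∈p∧x≢y⇒x∈p-y a∈U (x≢a ∘ sym)) (x∈p∧x≢y⇒x∈p-y b∈U (x≢b ∘ sym)) a≢b
      (branch w₁) (branch w₂)
    where
    x∈U─ab : x ∈ U ─ (⁅ a ⁆ ∪ ⁅ b ⁆)
    x∈U─ab = x∈p∧x∉q⇒x∈p─q x∈U ([ x≢y⇒x∉⁅y⁆ x≢a , x≢y⇒x∉⁅y⁆ x≢b ]′ ∘ x∈p∪q⁻ ⁅ a ⁆ ⁅ b ⁆)
    branch : ∀ {C′} → WaiterWins G (U ─ (⁅ a ⁆ ∪ ⁅ b ⁆)) C′ → WaiterWins G (U - x ─ (⁅ a ⁆ ∪ ⁅ b ⁆)) C′
    branch {C′} w = subst (λ V → WaiterWins G V C′) (p─q─r≡p─r─q U _ ⁅ x ⁆) (WaiterWins-remove x∈U─ab w)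

  EdgesWithinAvoid : Subset n → Subset n → Set
  EdgesWithinAvoid T D = ∀ e → e ∈E G → e ⊆ T ∪ D → ∀ {z} → z ∈ e → z ∉ D

  NoEdgeWithin-∪ : ∀ {S T D} → S ⊆ T → EdgesWithinAvoid T D → NoEdgeWithin G S → NoEdgeWithin G (S ∪ D)
  NoEdgeWithin-∪ {S} {T} {D} S⊆T avoid safe e e∈G e⊆S∪D = safe e e∈G e⊆S
    where
    e⊆S : e ⊆ S
    e⊆S z∈e with x∈p∪q⁻ S D (e⊆S∪D z∈e)
    ... | inj₁ z∈S = z∈S
    ... | inj₂ z∈D = contradiction z∈D (avoid e e∈G e⊆T∪D z∈e)
      where
      e⊆T∪D : e ⊆ T ∪ D
      e⊆T∪D y∈e = [ (λ y∈S → ∈∪ˡ (S⊆T y∈S)) , ∈∪ʳ ]′ (x∈p∪q⁻ S D (e⊆S∪D y∈e))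

  WaiterWins-∪ : ∀ {U C D} → EdgesWithinAvoid (U ∪ C) D → WaiterWins G U C → WaiterWins G U (C ∪ D)
  WaiterWins-∪ {U} {C} {D} avoid (end0 ∣U∣≡0 safe) = end0 ∣U∣≡0 (NoEdgeWithin-∪ (∈∪ʳ {p = U}) avoid safe)
  WaiterWins-∪ {U} {C} {D} avoid (end1 ∣U∣≡1 safe) =
    end1 ∣U∣≡1 (NoEdgeWithin-⊆ (subst (_ ∈_) (p∪q∪r≡p∪r∪q C D U))
                 (NoEdgeWithin-∪ ⊆U∪C avoid safe))
    where
    ⊆U∪C : C ∪ U ⊆ U ∪ C
    ⊆U∪C = subst (_ ∈_) (∪-comm C U)
  WaiterWins-∪ {U} {C} {D} avoid (offer a b a∈U b∈U a≢b w₁ w₂) =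
    offer a b a∈U b∈U a≢b (branch a∈U w₁) (branch b∈U w₂)
    where
    branch : ∀ {c} → c ∈ U → WaiterWins G (U ─ (⁅ a ⁆ ∪ ⁅ b ⁆)) (C ∪ ⁅ c ⁆) →
             WaiterWins G (U ─ (⁅ a ⁆ ∪ ⁅ b ⁆)) ((C ∪ D) ∪ ⁅ c ⁆)
    branch {c} c∈U w = subst (WaiterWins G _) (p∪q∪r≡p∪r∪q C ⁅ c ⁆ D) (WaiterWins-∪ avoid′ w)
      where
      shrink : (U ─ (⁅ a ⁆ ∪ ⁅ b ⁆)) ∪ (C ∪ ⁅ c ⁆) ⊆ U ∪ C
      shrink z∈ with x∈p∪q⁻ (U ─ _) _ z∈
      ... | inj₁ z∈U─ab = ∈∪ˡ (proj₁ (x∈p─q⁻ U _ z∈U─ab))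
      ... | inj₂ z∈C∪c = [ ∈∪ʳ , (λ z∈⁅c⁆ → ∈∪ˡ (y∈p⇒⁅y⁆⊆p c∈U z∈⁅c⁆)) ]′ (x∈p∪q⁻ C _ z∈C∪c)
      avoid′ : EdgesWithinAvoid ((U ─ (⁅ a ⁆ ∪ ⁅ b ⁆)) ∪ (C ∪ ⁅ c ⁆)) D
      avoid′ e e∈G e⊆ = avoid e e∈G λ z∈e →
        [ (λ z∈ → ∈∪ˡ (shrink z∈)) , ∈∪ʳ ]′ (x∈p∪q⁻ ((U ─ _) ∪ _) D (e⊆ z∈e))

  WaiterWins-remove₂ : ∀ {U C x y} → x ∈ U → y ∈ U → x ≢ y →
                       WaiterWins G U C → WaiterWins G (U ─ (⁅ x ⁆ ∪ ⁅ y ⁆)) C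
  WaiterWins-remove₂ {U} {C} {x} {y} x∈U y∈U x≢y w =
    subst (λ V → WaiterWins G V C) (p─q─r≡p─q∪r U ⁅ x ⁆ ⁅ y ⁆)
      (WaiterWins-remove (x∈p∧x≢y⇒x∈p-y y∈U (x≢y ∘ sym)) (WaiterWins-remove x∈U w))

-- Chains of triples and the family u-𝓕

toℕ≡⇒≡fromℕ : ∀ {k} {i : Fin (suc k)} → toℕ i ≡ k → i ≡ fromℕ k
toℕ≡⇒≡fromℕ {k} i≡k = toℕ-injective (trans i≡k (sym (toℕ-fromℕ k)))

Adjacent : ℕ → ℕ → (ℕ → Set) → Set
Adjacent i j P = i ≡ j ⊎ (j ≡ suc i × P j) ⊎ (i ≡ suc j × P i)

≡⇒≤suc : ∀ {i j} → i ≡ j → i ≤ suc j × j ≤ suc i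
≡⇒≤suc refl = ℕ.n≤1+n _ , ℕ.n≤1+n _

Adjacent⇒≤suc : ∀ {i j P} → Adjacent i j P → i ≤ suc j × j ≤ suc i
Adjacent⇒≤suc (inj₁ i≡j) = ≡⇒≤suc i≡j
Adjacent⇒≤suc (inj₂ (inj₁ (refl , _))) = ℕ.m≤n⇒m≤1+n (ℕ.n≤1+n _) , ℕ.≤-refl
Adjacent⇒≤suc (inj₂ (inj₂ (refl , _))) = ℕ.≤-refl , ℕ.m≤n⇒m≤1+n (ℕ.n≤1+n _)

update : ∀ {A : Set} → (ℕ → A) → ℕ → A → ℕ → A
update f k y i with i ℕ.≟ k
... | yes _ = y
... | no _ = f i

update-≡ : ∀ {A : Set} (f : ℕ → A) k y → update f k y k ≡ y
update-≡ f k y with k ℕ.≟ k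
... | yes _ = refl
... | no k≢k = contradiction refl k≢k

update-< : ∀ {A : Set} (f : ℕ → A) {k} y {i} → i < k → update f k y i ≡ f i
update-< f {k} y {i} i<k with i ℕ.≟ k
... | yes i≡k = contradiction i≡k (ℕ.<⇒≢ i<k)
... | no _ = refl

<suc-cases : ∀ {D} (P : ℕ → Set) → (∀ i → i < D → P i) → P D → ∀ i → i < suc D → P i
<suc-cases P below at-D i i<1+D with ℕ.m<1+n⇒m<n∨m≡n i<1+D
... | inj₁ i<D = below i i<D
... | inj₂ refl = at-D

≤suc-cases : ∀ {D} (P : ℕ → Set) → (∀ i → i ≤ D → P i) → P (suc D) → ∀ i → i ≤ suc D → P i
≤suc-cases P below at-1+D i i≤1+D with ℕ.m≤n⇒m<n∨m≡n i≤1+D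
... | inj₁ i<1+D = below i (ℕ.≤-pred i<1+D)
... | inj₂ refl = at-1+D

-- t i = {x i, x (suc i), b i} for i < D; x beyond D and b, t from D on are never consulted.
record Chain (G : Hypergraph n) (D : ℕ) (x b : ℕ → Fin n) (t : ℕ → Subset n) : Set where
  field
    edge∈G      : ∀ i → i < D → t i ∈E G
    ∣edge∣≡3    : ∀ i → i < D → ∣ t i ∣ ≡ 3
    x∈edge      : ∀ i → i < D → x i ∈ t i
    x-suc∈edge  : ∀ i → i < D → x (suc i) ∈ t i
    edge-cover  : ∀ i → i < D → ∀ {z} → z ∈ t i → z ≡ x i ⊎ z ≡ x (suc i) ⊎ z ≡ b i
    x-injective : ∀ i j → i ≤ D → j ≤ D → x i ≡ x j → i ≡ j
    b-injective : ∀ i j → i < D → j < D → b i ≡ b j → i ≡ j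
    x≢b         : ∀ i j → i ≤ D → j < D → x i ≢ b j

Fresh : ℕ → (ℕ → Fin n) → (ℕ → Fin n) → Fin n → Set
Fresh D x b z = (∀ i → i ≤ D → x i ≢ z) × (∀ i → i < D → b i ≢ z)

module _ {G : Hypergraph n} where

  Chain-empty : ∀ {x b t} → Chain G 0 x b t
  Chain-empty = record
    { edge∈G = λ _ () ; ∣edge∣≡3 = λ _ () ; x∈edge = λ _ () ; x-suc∈edge = λ _ ()
    ; edge-cover = λ _ () ; b-injective = λ _ _ () ; x≢b = λ _ _ _ ()
    ; x-injective = λ _ _ i≤0 j≤0 _ → trans (ℕ.n≤0⇒n≡0 i≤0) (sym (ℕ.n≤0⇒n≡0 j≤0)) }

  Chain-pop : ∀ {D x b t} → Chain G (suc D) x b t → Chain G D x b t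
  Chain-pop chain = record
    { edge∈G = λ i → edge∈G i ∘ ℕ.m<n⇒m<1+n ; ∣edge∣≡3 = λ i → ∣edge∣≡3 i ∘ ℕ.m<n⇒m<1+n
    ; x∈edge = λ i → x∈edge i ∘ ℕ.m<n⇒m<1+n ; x-suc∈edge = λ i → x-suc∈edge i ∘ ℕ.m<n⇒m<1+n
    ; edge-cover = λ i → edge-cover i ∘ ℕ.m<n⇒m<1+n
    ; x-injective = λ i j i≤D j≤D → x-injective i j (ℕ.m≤n⇒m≤1+n i≤D) (ℕ.m≤n⇒m≤1+n j≤D)
    ; b-injective = λ i j i<D j<D → b-injective i j (ℕ.m<n⇒m<1+n i<D) (ℕ.m<n⇒m<1+n j<D)
    ; x≢b = λ i j i≤D j<D → x≢b i j (ℕ.m≤n⇒m≤1+n i≤D) (ℕ.m<n⇒m<1+n j<D) }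
    where open Chain chain

  module Extension {D x b t g a a′} (chain : Chain G D x b t)
    (g∈G : g ∈E G) (∣g∣≡3 : ∣ g ∣ ≡ 3) (xD∈g : x D ∈ g) (a∈g : a ∈ g)
    (cover : ∀ {z} → z ∈ g → z ≡ x D ⊎ z ≡ a ⊎ z ≡ a′)
    (a-fresh : Fresh D x b a) (a′-fresh : Fresh D x b a′) (a≢a′ : a ≢ a′) where
    open Chain chain

    x′ : ℕ → Fin n
    x′ = update x (suc D) a

    b′ : ℕ → Fin n
    b′ = update b D a′

    t′ : ℕ → Subset n
    t′ = update t D g

    x′-old : ∀ {i} → i ≤ D → x′ i ≡ x i
    x′-old i≤D = update-< x a (s≤s i≤D)

    x′-new : x′ (suc D) ≡ a
    x′-new = update-≡ x (suc D) a

    b′-old : ∀ {i} → i < D → b′ i ≡ b i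
    b′-old i<D = update-< b a′ i<D

    b′-new : b′ D ≡ a′
    b′-new = update-≡ b D a′

    t′-old : ∀ {i} → i < D → t′ i ≡ t i
    t′-old i<D = update-< t g i<D

    t′-new : t′ D ≡ g
    t′-new = update-≡ t D g

    cover′ : ∀ i → i < suc D → ∀ {z} → z ∈ t′ i → z ≡ x′ i ⊎ z ≡ x′ (suc i) ⊎ z ≡ b′ i
    cover′ = <suc-cases (λ i → ∀ {z} → z ∈ t′ i → z ≡ x′ i ⊎ z ≡ x′ (suc i) ⊎ z ≡ b′ i) old new
      where
      old : ∀ i → i < D → ∀ {z} → z ∈ t′ i → z ≡ x′ i ⊎ z ≡ x′ (suc i) ⊎ z ≡ b′ i
      old i i<D z∈ with edge-cover i i<D (subst (_ ∈_) (t′-old i<D) z∈)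
      ... | inj₁ z≡x = inj₁ (trans z≡x (sym (x′-old (ℕ.<⇒≤ i<D))))
      ... | inj₂ (inj₁ z≡x) = inj₂ (inj₁ (trans z≡x (sym (x′-old i<D))))
      ... | inj₂ (inj₂ z≡b) = inj₂ (inj₂ (trans z≡b (sym (b′-old i<D))))
      new : ∀ {z} → z ∈ t′ D → z ≡ x′ D ⊎ z ≡ x′ (suc D) ⊎ z ≡ b′ D
      new z∈ with cover (subst (_ ∈_) t′-new z∈)
      ... | inj₁ z≡x = inj₁ (trans z≡x (sym (x′-old ℕ.≤-refl)))
      ... | inj₂ (inj₁ z≡a) = inj₂ (inj₁ (trans z≡a (sym x′-new)))
      ... | inj₂ (inj₂ z≡a′) = inj₂ (inj₂ (trans z≡a′ (sym b′-new)))

    x′-injective : ∀ i j → i ≤ suc D → j ≤ suc D → x′ i ≡ x′ j → i ≡ j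
    x′-injective i j i≤ j≤ eq with ℕ.m≤n⇒m<n∨m≡n i≤ | ℕ.m≤n⇒m<n∨m≡n j≤
    ... | inj₁ (s≤s i≤D) | inj₁ (s≤s j≤D) =
      x-injective i j i≤D j≤D (trans (sym (x′-old i≤D)) (trans eq (x′-old j≤D)))
    ... | inj₁ (s≤s i≤D) | inj₂ refl =
      contradiction (trans (sym (x′-old i≤D)) (trans eq x′-new)) (proj₁ a-fresh i i≤D)
    ... | inj₂ refl | inj₁ (s≤s j≤D) =
      contradiction (trans (sym (x′-old j≤D)) (trans (sym eq) x′-new)) (proj₁ a-fresh j j≤D)
    ... | inj₂ refl | inj₂ refl = refl

    b′-injective : ∀ i j → i < suc D → j < suc D → b′ i ≡ b′ j → i ≡ j
    b′-injective i j i< j< eq with ℕ.m<1+n⇒m<n∨m≡n i< | ℕ.m<1+n⇒m<n∨m≡n j<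
    ... | inj₁ i<D | inj₁ j<D =
      b-injective i j i<D j<D (trans (sym (b′-old i<D)) (trans eq (b′-old j<D)))
    ... | inj₁ i<D | inj₂ refl =
      contradiction (trans (sym (b′-old i<D)) (trans eq b′-new)) (proj₂ a′-fresh i i<D)
    ... | inj₂ refl | inj₁ j<D =
      contradiction (trans (sym (b′-old j<D)) (trans (sym eq) b′-new)) (proj₂ a′-fresh j j<D)
    ... | inj₂ refl | inj₂ refl = refl

    x′≢b′ : ∀ i j → i ≤ suc D → j < suc D → x′ i ≢ b′ j
    x′≢b′ i j i≤ j< eq with ℕ.m≤n⇒m<n∨m≡n i≤ | ℕ.m<1+n⇒m<n∨m≡n j<
    ... | inj₁ (s≤s i≤D) | inj₁ j<D = x≢b i j i≤D j<D (trans (sym (x′-old i≤D)) (trans eq (b′-old j<D)))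
    ... | inj₁ (s≤s i≤D) | inj₂ refl = proj₁ a′-fresh i i≤D (trans (sym (x′-old i≤D)) (trans eq b′-new))
    ... | inj₂ refl | inj₁ j<D = proj₂ a-fresh j j<D (sym (trans (sym x′-new) (trans eq (b′-old j<D))))
    ... | inj₂ refl | inj₂ refl = a≢a′ (trans (sym x′-new) (trans eq b′-new))

    extended : Chain G (suc D) x′ b′ t′
    extended = record
      { edge∈G = <suc-cases (λ i → t′ i ∈E G)
          (λ i i<D → subst (_∈E G) (sym (t′-old i<D)) (edge∈G i i<D))
          (subst (_∈E G) (sym t′-new) g∈G)
      ; ∣edge∣≡3 = <suc-cases (λ i → ∣ t′ i ∣ ≡ 3)
          (λ i i<D → subst (λ e → ∣ e ∣ ≡ 3) (sym (t′-old i<D)) (∣edge∣≡3 i i<D))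
          (subst (λ e → ∣ e ∣ ≡ 3) (sym t′-new) ∣g∣≡3)
      ; x∈edge = <suc-cases (λ i → x′ i ∈ t′ i)
          (λ i i<D → subst₂ _∈_ (sym (x′-old (ℕ.<⇒≤ i<D))) (sym (t′-old i<D)) (x∈edge i i<D))
          (subst₂ _∈_ (sym (x′-old ℕ.≤-refl)) (sym t′-new) xD∈g)
      ; x-suc∈edge = <suc-cases (λ i → x′ (suc i) ∈ t′ i)
          (λ i i<D → subst₂ _∈_ (sym (x′-old i<D)) (sym (t′-old i<D)) (x-suc∈edge i i<D))
          (subst₂ _∈_ (sym x′-new) (sym t′-new) a∈g)
      ; edge-cover = cover′
      ; x-injective = x′-injective
      ; b-injective = b′-injective
      ; x≢b = x′≢b′
      }

module ChainProperties {G : Hypergraph n} {D x b t} (chain : Chain G D x b t) where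
  open Chain chain

  x∈edge⇒index : ∀ k i → k ≤ D → i < D → x k ∈ t i → k ≡ i ⊎ k ≡ suc i
  x∈edge⇒index k i k≤D i<D xk∈ti with edge-cover i i<D xk∈ti
  ... | inj₁ xk≡xi = inj₁ (x-injective k i k≤D (ℕ.<⇒≤ i<D) xk≡xi)
  ... | inj₂ (inj₁ xk≡xi₊₁) = inj₂ (x-injective k (suc i) k≤D i<D xk≡xi₊₁)
  ... | inj₂ (inj₂ xk≡bi) = contradiction xk≡bi (x≢b k i k≤D i<D)

  shared-vertex : ∀ i j {z} → i < D → j < D → z ∈ t i → z ∈ t j → Adjacent i j (λ k → z ≡ x k)
  shared-vertex i j i<D j<D z∈ti z∈tj with edge-cover i i<D z∈ti
  ... | inj₁ refl with x∈edge⇒index i j (ℕ.<⇒≤ i<D) j<D z∈tj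
  ...   | inj₁ i≡j = inj₁ i≡j
  ...   | inj₂ i≡1+j = inj₂ (inj₂ (i≡1+j , refl))
  shared-vertex i j i<D j<D z∈ti z∈tj | inj₂ (inj₁ refl) with x∈edge⇒index (suc i) j i<D j<D z∈tj
  ...   | inj₁ 1+i≡j = inj₂ (inj₁ (sym 1+i≡j , cong x 1+i≡j))
  ...   | inj₂ 1+i≡1+j = inj₁ (ℕ.suc-injective 1+i≡1+j)
  shared-vertex i j i<D j<D z∈ti z∈tj | inj₂ (inj₂ refl) with edge-cover j j<D z∈tj
  ...   | inj₁ bi≡xj = contradiction (sym bi≡xj) (x≢b j i (ℕ.<⇒≤ j<D) i<D)
  ...   | inj₂ (inj₁ bi≡xj₊₁) = contradiction (sym bi≡xj₊₁) (x≢b (suc j) i j<D i<D)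
  ...   | inj₂ (inj₂ bi≡bj) = inj₁ (b-injective i j i<D j<D bi≡bj)

  ∣edge∩next∣≡1 : ∀ i → suc i < D → ∣ t i ∩ t (suc i) ∣ ≡ 1
  ∣edge∩next∣≡1 i 1+i<D =
    singleton⇒∣p∣≡1 {p = t i ∩ t (suc i)}
      (x∈p∩q⁺ (x-suc∈edge i (ℕ.<⇒≤ 1+i<D) , x∈edge (suc i) 1+i<D)) only
    where
    only : ∀ {z} → z ∈ t i ∩ t (suc i) → z ≡ x (suc i)
    only z∈ with x∈p∩q⁻ (t i) _ z∈
    ... | z∈ti , z∈ti₊₁ with shared-vertex i (suc i) (ℕ.<⇒≤ 1+i<D) 1+i<D z∈ti z∈ti₊₁
    ...   | inj₁ i≡1+i = contradiction (sym i≡1+i) ℕ.1+n≢n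
    ...   | inj₂ (inj₁ (_ , z≡x)) = z≡x
    ...   | inj₂ (inj₂ (i≡2+i , _)) = contradiction i≡2+i (ℕ.m≢1+n+m i {1})

  module Segment (J K : ℕ) (D≡K+J : D ≡ K + J) (g : Subset n) (g∈G : g ∈E G) (xD∈g : x D ∈ g) where

    <K⇒<D : ∀ {m} → m < K → m + J < D
    <K⇒<D {m} m<K = subst (m + J <_) (sym D≡K+J) (ℕ.+-monoˡ-< J m<K)

    edge : ℕ → Subset n
    edge m with m <? K
    ... | yes _ = t (m + J)
    ... | no _ = g

    edge-< : ∀ {m} → m < K → edge m ≡ t (m + J)
    edge-< {m} m<K with m <? K
    ... | yes _ = refl
    ... | no m≮K = contradiction m<K m≮K

    edge-≥ : ∀ {m} → K ≤ m → edge m ≡ g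
    edge-≥ {m} K≤m with m <? K
    ... | yes m<K = contradiction K≤m (ℕ.<⇒≱ m<K)
    ... | no _ = refl

    seq : EdgeSeq n K
    seq i = edge (toℕ i)

    seq-inject₁ : ∀ (i : Fin K) → seq (inject₁ i) ≡ t (toℕ i + J)
    seq-inject₁ i = trans (cong edge (toℕ-inject₁ i)) (edge-< (toℕ<n i))

    seq-last : seq (fromℕ K) ≡ g
    seq-last = trans (cong edge (toℕ-fromℕ K)) (edge-≥ ℕ.≤-refl)

    data Position (i : Fin (suc K)) : Set where
      inner : toℕ i < K → seq i ≡ t (toℕ i + J) → Position i
      last  : toℕ i ≡ K → seq i ≡ g → Position i

    position : ∀ i → Position i
    position i with toℕ i <? K
    ... | yes i<K = inner i<K (edge-< i<K)
    ... | no i≮K = last i≡K (edge-≥ (ℕ.≤-reflexive (sym i≡K)))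
      where
      i≡K : toℕ i ≡ K
      i≡K = ℕ.≤-antisym (toℕ≤pred[n] i) (ℕ.≮⇒≥ i≮K)

    seq∈G : InG G seq
    seq∈G i with position i
    ... | inner i<K eq = subst (_∈E G) (sym eq) (edge∈G _ (<K⇒<D i<K))
    ... | last _ eq = subst (_∈E G) (sym eq) g∈G

    x[m+J]∈g : ∀ m → m ≡ K → x (m + J) ∈ g
    x[m+J]∈g m m≡K = subst (λ k → x k ∈ g) (trans D≡K+J (cong (_+ J) (sym m≡K))) xD∈g

    consecutive : Consecutive seq
    consecutive i = x (suc (toℕ i + J)) , x∈p∩q⁺ (in-seq-i , in-seq-1+i)
      where
      in-seq-i : x (suc (toℕ i + J)) ∈ seq (inject₁ i)
      in-seq-i = subst (_ ∈_) (sym (seq-inject₁ i)) (x-suc∈edge _ (<K⇒<D (toℕ<n i)))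
      in-seq-1+i : x (suc (toℕ i + J)) ∈ seq (Fin.suc i)
      in-seq-1+i with position (Fin.suc i)
      ... | inner 1+i<K eq = subst (_ ∈_) (sym eq) (x∈edge _ (<K⇒<D 1+i<K))
      ... | last 1+i≡K eq = subst (_ ∈_) (sym eq) (x[m+J]∈g (suc (toℕ i)) 1+i≡K)

    xJ∈first : x J ∈ seq Fin.zero
    xJ∈first with position Fin.zero
    ... | inner 0<K eq = subst (_ ∈_) (sym eq) (x∈edge J (<K⇒<D 0<K))
    ... | last 0≡K eq = subst (_ ∈_) (sym eq) (x[m+J]∈g 0 0≡K)

  snake-member : ∀ {g} → g ∈E G → x D ∈ g → ∣ g ∣ ≤ 2 → FamilyMember G (x 0)
  snake-member {g} g∈G xD∈g ∣g∣≤2 =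
    snake D seq seq∈G
      ((x D , xJ∈first , subst (x D ∈_) (sym seq-last) xD∈g , consecutive) , sizes , last-size)
    where
    open Segment 0 D (sym (ℕ.+-identityʳ D)) g g∈G xD∈g
    sizes : ∀ i → ∣ seq (inject₁ i) ∣ ≡ 3
    sizes i = subst (λ e → ∣ e ∣ ≡ 3) (sym (seq-inject₁ i)) (∣edge∣≡3 _ (<K⇒<D (toℕ<n i)))
    last-size : ∣ seq (fromℕ D) ∣ ≤ 2
    last-size = subst (λ e → ∣ e ∣ ≤ 2) (sym seq-last) ∣g∣≤2

  record ClosingEdge (J : ℕ) (g : Subset n) : Set where
    field
      J<D   : J < D
      g∈G   : g ∈E G
      ∣g∣≡3 : ∣ g ∣ ≡ 3
      xJ∈g  : x J ∈ g
      xD∈g  : x D ∈ g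
      g-x   : ∀ i → i ≤ D → x i ∈ g → i ≡ J ⊎ i ≡ D
      g∌b   : ∀ i → i < D → b i ∉ g

  module Loop {J g} (closing : ClosingEdge J g) where
    open ClosingEdge closing

    K : ℕ
    K = D ∸ J

    1≤K : 1 ≤ K
    1≤K = ℕ.m<n⇒0<n∸m J<D

    D≡K+J : D ≡ K + J
    D≡K+J = sym (ℕ.m∸n+n≡m (ℕ.<⇒≤ J<D))

    open Segment J K D≡K+J g g∈G xD∈g public

    edge∩g : ∀ {m z} → m < K → z ∈ t (m + J) → z ∈ g →
             (m ≡ 0 × z ≡ x J) ⊎ (suc m ≡ K × z ≡ x (suc (m + J)))
    edge∩g {m} m<K z∈t z∈g with edge-cover (m + J) (<K⇒<D m<K) z∈t
    ... | inj₁ refl with g-x (m + J) (ℕ.<⇒≤ (<K⇒<D m<K)) z∈g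
    ...   | inj₁ m+J≡J = inj₁ (ℕ.+-cancelʳ-≡ J m 0 m+J≡J , cong x m+J≡J)
    ...   | inj₂ m+J≡D = contradiction (ℕ.+-cancelʳ-≡ J m K (trans m+J≡D D≡K+J)) (ℕ.<⇒≢ m<K)
    edge∩g {m} m<K z∈t z∈g | inj₂ (inj₁ refl) with g-x (suc (m + J)) (<K⇒<D m<K) z∈g
    ...   | inj₁ 1+m+J≡J = contradiction (sym 1+m+J≡J) (ℕ.m≢1+n+m J)
    ...   | inj₂ 1+m+J≡D = inj₂ (ℕ.+-cancelʳ-≡ J (suc m) K (trans 1+m+J≡D D≡K+J) , refl)
    edge∩g {m} m<K z∈t z∈g | inj₂ (inj₂ refl) = contradiction z∈g (g∌b (m + J) (<K⇒<D m<K))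

    seq-first : seq Fin.zero ≡ t J
    seq-first = edge-< 1≤K

    uniform : Uniform3 seq
    uniform i with position i
    ... | inner i<K eq = subst (λ e → ∣ e ∣ ≡ 3) (sym eq) (∣edge∣≡3 _ (<K⇒<D i<K))
    ... | last _ eq = subst (λ e → ∣ e ∣ ≡ 3) (sym eq) ∣g∣≡3

    is-cycle : IsCycle (x J) seq
    is-cycle = (xJ∈first , subst (x J ∈_) (sym seq-last) xJ∈g , consecutive) , 1≤K

    ∣edge∩g∣≡1 : ∀ m → 1 < suc m → suc m ≡ K → ∣ t (m + J) ∩ g ∣ ≡ 1
    ∣edge∩g∣≡1 m 1<1+m 1+m≡K = singleton⇒∣p∣≡1 {p = t (m + J) ∩ g}
      (x∈p∩q⁺ (x-suc∈edge _ (<K⇒<D m<K) , x[m+J]∈g (suc m) 1+m≡K)) only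
      where
      m<K : m < K
      m<K = ℕ.≤-reflexive 1+m≡K
      only : ∀ {z} → z ∈ t (m + J) ∩ g → z ≡ x (suc (m + J))
      only z∈ with x∈p∩q⁻ (t (m + J)) g z∈
      ... | z∈t , z∈g with edge∩g m<K z∈t z∈g
      ...   | inj₁ (refl , _) = contradiction 1<1+m (ℕ.n≮n 1)
      ...   | inj₂ (_ , z≡x) = z≡x

    t[J]∩g≡⁅xJ⁆ : 1 < K → t J ∩ g ≡ ⁅ x J ⁆
    t[J]∩g≡⁅xJ⁆ 1<K = ⊆-antisym to from
      where
      to : ∀ {z} → z ∈ t J ∩ g → z ∈ ⁅ x J ⁆
      to z∈ with x∈p∩q⁻ (t J) g z∈
      ... | z∈t , z∈g with edge∩g 1≤K z∈t z∈g
      ...   | inj₁ (_ , z≡xJ) = x≡y⇒x∈⁅y⁆ z≡xJ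
      ...   | inj₂ (1≡K , _) = contradiction (sym 1≡K) (ℕ.<⇒≢ 1<K ∘ sym)
      from : ∀ {z} → z ∈ ⁅ x J ⁆ → z ∈ t J ∩ g
      from z∈ with x∈⁅y⁆⇒x≡y (x J) z∈
      ... | refl = x∈p∩q⁺ (x∈edge J J<D , xJ∈g)

    linear : LinearCycle (x J) seq
    linear with ℕ.m≤n⇒m<n∨m≡n 1≤K
    ... | inj₂ 1≡K =
      inj₂ (sym 1≡K , subst₂ (λ e f → ∣ e ∩ f ∣ ≡ 2) (sym seq-first) (sym seq-last) ∣t[J]∩g∣≡2)
      where
      xJ≢xJ₊₁ : x J ≢ x (suc J)
      xJ≢xJ₊₁ eq = ℕ.1+n≢n (sym (x-injective J (suc J) (ℕ.<⇒≤ J<D) J<D eq))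
      cover : ∀ {z} → z ∈ t J ∩ g → z ≡ x J ⊎ z ≡ x (suc J)
      cover z∈ with x∈p∩q⁻ (t J) g z∈
      ... | z∈t , z∈g with edge∩g 1≤K z∈t z∈g
      ...   | inj₁ (_ , z≡xJ) = inj₁ z≡xJ
      ...   | inj₂ (_ , z≡xJ₊₁) = inj₂ z≡xJ₊₁
      ∣t[J]∩g∣≡2 : ∣ t J ∩ g ∣ ≡ 2
      ∣t[J]∩g∣≡2 = pair⇒∣p∣≡2 xJ≢xJ₊₁ (x∈p∩q⁺ (x∈edge J J<D , xJ∈g))
                     (x∈p∩q⁺ (x-suc∈edge J J<D , x[m+J]∈g 1 1≡K)) cover
    ... | inj₁ 1<K =
      inj₁ (1<K , consecutive-linear ,
            subst₂ (λ e f → e ∩ f ≡ ⁅ x J ⁆) (sym seq-first) (sym seq-last) (t[J]∩g≡⁅xJ⁆ 1<K))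
      where
      consecutive-linear : LinearConsec seq
      consecutive-linear i with position (Fin.suc i)
      ... | inner 1+i<K eq = subst₂ (λ e f → ∣ e ∩ f ∣ ≡ 1) (sym (seq-inject₁ i)) (sym eq)
                               (∣edge∩next∣≡1 (toℕ i + J) (<K⇒<D 1+i<K))
      ... | last 1+i≡K eq = subst₂ (λ e f → ∣ e ∩ f ∣ ≡ 1) (sym (seq-inject₁ i)) (sym eq)
                              (∣edge∩g∣≡1 (toℕ i) (subst (1 <_) (sym 1+i≡K) 1<K) 1+i≡K)

    CycleNear : Fin (suc K) → Fin (suc K) → Set
    CycleNear i j = Near {n = n} i j ⊎ (i ≡ Fin.zero × j ≡ fromℕ K) ⊎ (i ≡ fromℕ K × j ≡ Fin.zero)

    CycleNear-sym : ∀ {i j} → CycleNear i j → CycleNear j i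
    CycleNear-sym (inj₁ (i≤1+j , j≤1+i)) = inj₁ (j≤1+i , i≤1+j)
    CycleNear-sym (inj₂ (inj₁ (i≡0 , j≡K))) = inj₂ (inj₂ (j≡K , i≡0))
    CycleNear-sym (inj₂ (inj₂ (i≡K , j≡0))) = inj₂ (inj₁ (j≡0 , i≡K))

    inner∩last : ∀ i j {z} → toℕ i < K → toℕ j ≡ K → z ∈ t (toℕ i + J) → z ∈ g → CycleNear i j
    inner∩last i j i<K j≡K z∈t z∈g with edge∩g i<K z∈t z∈g
    ... | inj₁ (i≡0 , _) = inj₂ (inj₁ (toℕ-injective i≡0 , toℕ≡⇒≡fromℕ j≡K))
    ... | inj₂ (1+i≡K , _) = inj₁ (subst (toℕ i ≤_) (cong suc (sym j≡K)) (ℕ.m≤n⇒m≤1+n (ℕ.<⇒≤ i<K))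
                                  , ℕ.≤-reflexive (trans j≡K (sym 1+i≡K)))

    simple : SimpleCycle seq
    simple i j (z , z∈) with x∈p∩q⁻ (seq i) (seq j) z∈ | position i | position j
    ... | z∈i , z∈j | inner i<K eqi | inner j<K eqj =
      inj₁ (cancel-J (Adjacent⇒≤suc {P = λ k → z ≡ x k}
        (shared-vertex _ _ (<K⇒<D i<K) (<K⇒<D j<K) (subst (z ∈_) eqi z∈i) (subst (z ∈_) eqj z∈j))))
      where
      cancel-J : ∀ {a c} → a + J ≤ suc (c + J) × c + J ≤ suc (a + J) → a ≤ suc c × c ≤ suc a
      cancel-J {a} {c} (p , q) = ℕ.+-cancelʳ-≤ J a (suc c) p , ℕ.+-cancelʳ-≤ J c (suc a) q
    ... | z∈i , z∈j | inner i<K eqi | last j≡K eqj =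
      inner∩last i j i<K j≡K (subst (z ∈_) eqi z∈i) (subst (z ∈_) eqj z∈j)
    ... | z∈i , z∈j | last i≡K eqi | inner j<K eqj =
      CycleNear-sym (inner∩last j i j<K i≡K (subst (z ∈_) eqj z∈j) (subst (z ∈_) eqi z∈i))
    ... | _ | last i≡K _ | last j≡K _ = inj₁ (≡⇒≤suc (trans i≡K (sym j≡K)))

    simple-linear-cycle : SimpleLinear3Cycle (x J) seq
    simple-linear-cycle = uniform , is-cycle , linear , simple

  cycle-member : ∀ {g} → ClosingEdge 0 g → FamilyMember G (x 0)
  cycle-member closing = cycle K seq seq∈G simple-linear-cycle
    where open Loop closing

  module Tadpole {J′ g} (closing : ClosingEdge (suc J′) g) where
    open ClosingEdge closing
    open Loop closing

    J : ℕ
    J = suc J′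

    path : EdgeSeq n J′
    path i = t (toℕ i)

    path-index<D : ∀ (i : Fin J) → toℕ i < D
    path-index<D i = ℕ.<-trans (toℕ<n i) J<D

    0<D : 0 < D
    0<D = ℕ.≤-<-trans z≤n J<D

    x0≢xJ : x 0 ≢ x J
    x0≢xJ eq = ℕ.0≢1+n (x-injective 0 J z≤n (ℕ.<⇒≤ J<D) eq)

    x0∈path⇒first : ∀ i → x 0 ∈ path i → i ≡ Fin.zero
    x0∈path⇒first i x0∈ with x∈edge⇒index 0 (toℕ i) z≤n (path-index<D i) x0∈
    ... | inj₁ 0≡i = toℕ-injective (sym 0≡i)
    ... | inj₂ 0≡1+i = contradiction 0≡1+i ℕ.0≢1+n

    x0∉seq : ∀ j → x 0 ∉ seq j
    x0∉seq j x0∈ with position j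
    ... | inner j<K eq with x∈edge⇒index 0 (toℕ j + J) z≤n (<K⇒<D j<K) (subst (x 0 ∈_) eq x0∈)
    ...   | inj₁ 0≡j+J = ℕ.m+1+n≢0 (toℕ j) (sym 0≡j+J)
    ...   | inj₂ 0≡1+j+J = ℕ.0≢1+n 0≡1+j+J
    x0∉seq j x0∈ | last _ eq with g-x 0 z≤n (subst (x 0 ∈_) eq x0∈)
    ...   | inj₁ 0≡J = ℕ.0≢1+n 0≡J
    ...   | inj₂ 0≡D = ℕ.<⇒≢ 0<D 0≡D

    xJ∈path⇒last : ∀ i → x J ∈ path i → i ≡ fromℕ J′
    xJ∈path⇒last i xJ∈ with x∈edge⇒index J (toℕ i) (ℕ.<⇒≤ J<D) (path-index<D i) xJ∈
    ... | inj₁ J≡i = contradiction (sym J≡i) (ℕ.<⇒≢ (toℕ<n i))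
    ... | inj₂ J≡1+i = toℕ≡⇒≡fromℕ (ℕ.suc-injective (sym J≡1+i))

    xJ∈seq⇒ends : ∀ j → x J ∈ seq j → j ≡ Fin.zero ⊎ j ≡ fromℕ K
    xJ∈seq⇒ends j xJ∈ with position j
    ... | last j≡K _ = inj₂ (toℕ≡⇒≡fromℕ j≡K)
    ... | inner j<K eq with x∈edge⇒index J (toℕ j + J) (ℕ.<⇒≤ J<D) (<K⇒<D j<K) (subst (x J ∈_) eq xJ∈)
    ...   | inj₁ J≡j+J = inj₁ (toℕ-injective (ℕ.+-cancelʳ-≡ J (toℕ j) 0 (sym J≡j+J)))
    ...   | inj₂ J≡1+j+J = contradiction J≡1+j+J (ℕ.m≢1+n+m J)

    path-consecutive : Consecutive path
    path-consecutive i = x (suc (toℕ i)) , x∈p∩q⁺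
      ( subst (λ k → x (suc (toℕ i)) ∈ t k) (sym (toℕ-inject₁ i))
          (x-suc∈edge (toℕ i) (ℕ.<⇒≤ (path-index<D (Fin.suc i))))
      , x∈edge _ (path-index<D (Fin.suc i)) )

    path-is-path : IsPath (x 0) (x J) path
    path-is-path = x∈edge 0 0<D
                 , subst (λ k → x J ∈ t k) (sym (toℕ-fromℕ J′)) (x-suc∈edge J′ (ℕ.<-trans (ℕ.n<1+n J′) J<D))
                 , path-consecutive

    path-simple : SimplePath (x 0) (x J) path
    path-simple = x0∈path⇒first , xJ∈path⇒last , near
      where
      near : ∀ i j → Nonempty (path i ∩ path j) → Near {n = n} i j
      near i j (z , z∈) with x∈p∩q⁻ (path i) (path j) z∈
      ... | z∈i , z∈j =
        Adjacent⇒≤suc {P = λ k → z ≡ x k} (shared-vertex _ _ (path-index<D i) (path-index<D j) z∈i z∈j)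

    path-linear : LinearConsec path
    path-linear i = subst (λ k → ∣ t k ∩ t (suc (toℕ i)) ∣ ≡ 1) (sym (toℕ-inject₁ i))
                      (∣edge∩next∣≡1 (toℕ i) (path-index<D (Fin.suc i)))

    path∩seq : ∀ z i j → z ∈ path i → z ∈ seq j → z ≡ x J
    path∩seq z i j z∈i z∈j with position j
    ... | inner j<K eq
      with shared-vertex (toℕ i) (toℕ j + J) (path-index<D i) (<K⇒<D j<K) z∈i (subst (z ∈_) eq z∈j)
    ...   | inj₁ i≡j+J = contradiction i≡j+J (ℕ.<⇒≢ (ℕ.<-≤-trans (toℕ<n i) (ℕ.m≤n+m J (toℕ j))))
    ...   | inj₂ (inj₁ (j+J≡1+i , z≡x)) =
      trans z≡x (cong x (ℕ.≤-antisym (subst (_≤ J) (sym j+J≡1+i) (toℕ<n i)) (ℕ.m≤n+m J (toℕ j))))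
    ...   | inj₂ (inj₂ (i≡1+j+J , _)) =
      contradiction i≡1+j+J (ℕ.<⇒≢ (ℕ.<-≤-trans (toℕ<n i) (ℕ.m≤n⇒m≤1+n (ℕ.m≤n+m J (toℕ j)))))
    path∩seq z i j z∈i z∈j | last _ eq with edge-cover (toℕ i) (path-index<D i) z∈i | subst (z ∈_) eq z∈j
    ... | inj₁ refl | z∈g with g-x (toℕ i) (ℕ.<⇒≤ (path-index<D i)) z∈g
    ...   | inj₁ i≡J = contradiction i≡J (ℕ.<⇒≢ (toℕ<n i))
    ...   | inj₂ i≡D = contradiction i≡D (ℕ.<⇒≢ (path-index<D i))
    path∩seq z i j z∈i z∈j | last _ eq | inj₂ (inj₁ refl) | z∈g with g-x (suc (toℕ i)) (path-index<D i) z∈g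
    ...   | inj₁ 1+i≡J = cong x 1+i≡J
    ...   | inj₂ 1+i≡D = contradiction 1+i≡D (ℕ.<⇒≢ (ℕ.≤-<-trans (toℕ<n i) J<D))
    path∩seq z i j z∈i z∈j | last _ eq | inj₂ (inj₂ refl) | z∈g =
      contradiction z∈g (g∌b (toℕ i) (path-index<D i))

    member : FamilyMember G (x 0)
    member = tadpole (x J) J′ K path seq (λ i → edge∈G _ (path-index<D i)) seq∈G
      ( x0≢xJ , x0∈path⇒first , x0∉seq , xJ∈path⇒last , xJ∈seq⇒ends
      , ((λ i → ∣edge∣≡3 _ (path-index<D i)) , path-is-path , path-simple , path-linear)
      , simple-linear-cycle , path∩seq )

  closing-member : ∀ {J g} → ClosingEdge J g → FamilyMember G (x 0)
  closing-member {zero} = cycle-member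
  closing-member {suc J′} = Tadpole.member

-- Waiter's strategy once Client owns u

module ChainStrategy {n} {H : Hypergraph n} {u v : Fin n} (u≢v : u ≢ v)
  (rank≤3 : ∀ e → e ∈E H → ∣ e ∣ ≤ 3) (no-family : FamilyEmpty (removeVertex H v) u) where

  G : Hypergraph n
  G = removeVertex H v

  Alive : Subset n → Subset n → Subset n → Set
  Alive U C g = g ⊆ U ∪ C

  alive⇒∈G : ∀ {U C g} → v ∉ U → v ∉ C → g ∈E H → Alive U C g → g ∈E G
  alive⇒∈G v∉U v∉C g∈H alive =
    ∈-filter⁺ (λ e → ¬? (v ∈? e)) g∈H (λ v∈g → [ v∉U , v∉C ]′ (x∈p∪q⁻ _ _ (alive v∈g)))

  no-snake⇒∣g∣≡3 : ∀ {D x b t g} → Chain G D x b t → x 0 ≡ u →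
                   g ∈E H → g ∈E G → x D ∈ g → ∣ g ∣ ≡ 3
  no-snake⇒∣g∣≡3 {g = g} chain x0≡u g∈H g∈G xD∈g with ∣ g ∣ ℕ.≟ 3
  ... | yes ∣g∣≡3 = ∣g∣≡3
  ... | no ∣g∣≢3 = contradiction (subst (FamilyMember G) x0≡u (snake-member g∈G xD∈g ∣g∣≤2)) no-family
    where
    open ChainProperties chain
    ∣g∣≤2 : ∣ g ∣ ≤ 2
    ∣g∣≤2 = ℕ.≤-pred (ℕ.≤∧≢⇒< (rank≤3 g g∈H) ∣g∣≢3)

  AliveEdgesMeetPath : Subset n → Subset n → ℕ → (ℕ → Fin n) → Set
  AliveEdgesMeetPath U C D x = ∀ g → g ∈E H → Alive U C g → ∀ {c} → c ∈ C → c ∈ g →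
    (∃ λ i → i ≤ D × c ≡ x i) × (∀ {c′} → c′ ∈ C → c′ ∈ g → c′ ≡ c) × ∣ g ∣ ≡ 3

  -- U is unclaimed, C is Client's, and Waiter owns everything else, including v and every b i.
  record Invariant (U C : Subset n) (D : ℕ) (x b : ℕ → Fin n) (t : ℕ → Subset n) : Set where
    field
      chain : Chain G D x b t
      x0≡u  : x 0 ≡ u
      x∈C   : ∀ i → i ≤ D → x i ∈ C
      b∉U   : ∀ i → i < D → b i ∉ U
      b∉C   : ∀ i → i < D → b i ∉ C
      U∩C   : ∀ {z} → z ∈ U → z ∉ C
      v∉U   : v ∉ U
      v∉C   : v ∉ C
      alive-edge : AliveEdgesMeetPath U C D x

  initial : ∀ {U} → u ∉ U → v ∉ U → Invariant U ⁅ u ⁆ 0 (λ _ → u) (λ _ → u) (λ _ → ∅)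
  initial {U} u∉U v∉U = record
    { chain = chain₀ ; x0≡u = refl ; x∈C = λ _ _ → x∈⁅x⁆ u
    ; b∉U = λ _ () ; b∉C = λ _ ()
    ; U∩C = λ z∈U z∈⁅u⁆ → u∉U (subst (_∈ U) (is-u z∈⁅u⁆) z∈U)
    ; v∉U = v∉U ; v∉C = u≢v ∘ sym ∘ is-u
    ; alive-edge = λ g g∈H alive c∈⁅u⁆ c∈g →
        (0 , z≤n , is-u c∈⁅u⁆) , (λ c′∈⁅u⁆ _ → trans (is-u c′∈⁅u⁆) (sym (is-u c∈⁅u⁆))) ,
        no-snake⇒∣g∣≡3 chain₀ refl g∈H (alive⇒∈G v∉U (u≢v ∘ sym ∘ is-u) g∈H alive)
          (subst (_∈ g) (is-u c∈⁅u⁆) c∈g) }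
    where
    chain₀ : Chain G 0 (λ _ → u) (λ _ → u) (λ _ → ∅)
    chain₀ = Chain-empty
    is-u : ∀ {z} → z ∈ ⁅ u ⁆ → z ≡ u
    is-u = x∈⁅y⁆⇒x≡y u

  module Push {U C D x b t} (I : Invariant U C D x b t) {g a a′} (g∈H : g ∈E H) (alive : Alive U C g)
    (∣g∣≡3 : ∣ g ∣ ≡ 3) (xD∈g : x D ∈ g) (a∈g : a ∈ g) (a∈U : a ∈ U) (a′∈U : a′ ∈ U)
    (a≢a′ : a ≢ a′) (cover : ∀ {z} → z ∈ g → z ≡ x D ⊎ z ≡ a ⊎ z ≡ a′) where
    open Invariant I

    U′ : Subset n
    U′ = U ─ (⁅ a ⁆ ∪ ⁅ a′ ⁆)

    C′ : Subset n
    C′ = C ∪ ⁅ a ⁆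

    fresh : ∀ {z} → z ∈ U → Fresh D x b z
    fresh z∈U = (λ i i≤D xi≡z → U∩C z∈U (subst (_∈ C) xi≡z (x∈C i i≤D)))
              , (λ i i<D bi≡z → b∉U i i<D (subst (_∈ U) (sym bi≡z) z∈U))

    open Extension chain (alive⇒∈G v∉U v∉C g∈H alive) ∣g∣≡3 xD∈g a∈g cover (fresh a∈U) (fresh a′∈U) a≢a′
      using (x′; b′; t′; x′-old; x′-new; b′-old; b′-new) renaming (extended to chain′)

    x′0≡u : x′ 0 ≡ u
    x′0≡u = trans (x′-old z≤n) x0≡u

    ⁅a⁆⊆U : ⁅ a ⁆ ⊆ U
    ⁅a⁆⊆U = y∈p⇒⁅y⁆⊆p a∈U

    x′∈C′ : ∀ i → i ≤ suc D → x′ i ∈ C′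
    x′∈C′ = ≤suc-cases (λ i → x′ i ∈ C′)
      (λ i i≤D → subst (_∈ C′) (sym (x′-old i≤D)) (∈∪ˡ (x∈C i i≤D)))
      (subst (_∈ C′) (sym x′-new) (∈∪ʳ {p = C} (x∈⁅x⁆ a)))

    b′∉U′ : ∀ i → i < suc D → b′ i ∉ U′
    b′∉U′ = <suc-cases (λ i → b′ i ∉ U′)
      (λ i i<D b′i∈U′ → b∉U i i<D (subst (_∈ U) (b′-old i<D) (proj₁ (x∈p─q⁻ U _ b′i∈U′))))
      (λ b′D∈U′ → proj₂ (x∈p─q⁻ U _ (subst (_∈ U′) b′-new b′D∈U′)) (∈∪ʳ {p = ⁅ a ⁆} (x∈⁅x⁆ a′)))

    b′∉C′ : ∀ i → i < suc D → b′ i ∉ C′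
    b′∉C′ = <suc-cases (λ i → b′ i ∉ C′)
      (λ i i<D b′i∈C′ → [ b∉C i i<D , b∉U i i<D ∘ ⁅a⁆⊆U ]′
                          (x∈p∪q⁻ C _ (subst (_∈ C′) (b′-old i<D) b′i∈C′)))
      (λ b′D∈C′ → [ U∩C a′∈U , a≢a′ ∘ sym ∘ x∈⁅y⁆⇒x≡y a ]′ (x∈p∪q⁻ C _ (subst (_∈ C′) b′-new b′D∈C′)))

    U′∩C′ : ∀ {z} → z ∈ U′ → z ∉ C′
    U′∩C′ z∈U′ z∈C′ with x∈p─q⁻ U _ z∈U′
    ... | z∈U , z∉aa′ = [ U∩C z∈U , z∉aa′ ∘ ∈∪ˡ ]′ (x∈p∪q⁻ C _ z∈C′)

    v∉U′ : v ∉ U′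
    v∉U′ = v∉U ∘ proj₁ ∘ x∈p─q⁻ U _

    v∉C′ : v ∉ C′
    v∉C′ v∈C′ = [ v∉C , v∉U ∘ ⁅a⁆⊆U ]′ (x∈p∪q⁻ C _ v∈C′)

    alive-before : ∀ {g′} → Alive U′ C′ g′ → Alive U C g′
    alive-before alive′ z∈g′ with x∈p∪q⁻ U′ _ (alive′ z∈g′)
    ... | inj₁ z∈U′ = ∈∪ˡ (proj₁ (x∈p─q⁻ U _ z∈U′))
    ... | inj₂ z∈C′ = [ ∈∪ʳ , ∈∪ˡ ∘ ⁅a⁆⊆U ]′ (x∈p∪q⁻ C _ z∈C′)

    x′-new∈ : ∀ {g′} → a ∈ g′ → x′ (suc D) ∈ g′
    x′-new∈ {g′} = subst (_∈ g′) (sym x′-new)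

    no-loop : ∀ {g′ c₀} → g′ ∈E H → Alive U′ C′ g′ → a ∈ g′ → c₀ ∈ C → c₀ ∉ g′
    no-loop {g′} {c₀} g′∈H alive′ a∈g′ c₀∈C c₀∈g′
      with (j , j≤D , c₀≡xj) , only-c₀ , ∣g′∣≡3 ← alive-edge g′ g′∈H (alive-before alive′) c₀∈C c₀∈g′ =
      no-family (subst (FamilyMember G) x′0≡u (closing-member closing))
      where
      open ChainProperties chain′
      closing : ClosingEdge j g′
      closing = record
        { J<D = s≤s j≤D
        ; g∈G = alive⇒∈G v∉U′ v∉C′ g′∈H alive′
        ; ∣g∣≡3 = ∣g′∣≡3
        ; xJ∈g = subst (_∈ g′) (trans c₀≡xj (sym (x′-old j≤D))) c₀∈g′
        ; xD∈g = x′-new∈ a∈g′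
        ; g-x = ≤suc-cases (λ i → x′ i ∈ g′ → i ≡ j ⊎ i ≡ suc D)
            (λ i i≤D x′i∈g′ → inj₁ (Chain.x-injective chain i j i≤D j≤D
              (trans (only-c₀ (x∈C i i≤D) (subst (_∈ g′) (x′-old i≤D) x′i∈g′)) c₀≡xj)))
            (λ _ → inj₂ refl)
        ; g∌b = λ i i<1+D b′i∈g′ → [ b′∉U′ i i<1+D , b′∉C′ i i<1+D ]′ (x∈p∪q⁻ U′ _ (alive′ b′i∈g′))
        }

    in-C : ∀ {g′ z} → a ∉ g′ → z ∈ C′ → z ∈ g′ → z ∈ C
    in-C {g′} a∉g′ z∈C′ z∈g′ =
      [ (λ z∈C → z∈C) , (λ z∈⁅a⁆ → contradiction (subst (_∈ g′) (x∈⁅y⁆⇒x≡y a z∈⁅a⁆) z∈g′) a∉g′) ]′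
        (x∈p∪q⁻ C _ z∈C′)

    alive-edge′ : AliveEdgesMeetPath U′ C′ (suc D) x′
    alive-edge′ g′ g′∈H alive′ {c} c∈C′ c∈g′ with a ∈? g′
    ... | yes a∈g′ =
      (suc D , ℕ.≤-refl , trans (is-a c∈C′ c∈g′) (sym x′-new)) ,
      (λ c′∈C′ c′∈g′ → trans (is-a c′∈C′ c′∈g′) (sym (is-a c∈C′ c∈g′))) ,
      no-snake⇒∣g∣≡3 chain′ x′0≡u g′∈H (alive⇒∈G v∉U′ v∉C′ g′∈H alive′) (x′-new∈ a∈g′)
      where
      is-a : ∀ {z} → z ∈ C′ → z ∈ g′ → z ≡ a
      is-a z∈C′ z∈g′ =
        [ (λ z∈C → contradiction z∈g′ (no-loop g′∈H alive′ a∈g′ z∈C)) , x∈⁅y⁆⇒x≡y a ]′ (x∈p∪q⁻ C _ z∈C′)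
    ... | no a∉g′
      with (i , i≤D , c≡xi) , only-c , ∣g′∣≡3
             ← alive-edge g′ g′∈H (alive-before alive′) (in-C a∉g′ c∈C′ c∈g′) c∈g′ =
      (i , ℕ.m≤n⇒m≤1+n i≤D , trans c≡xi (sym (x′-old i≤D))) ,
      (λ c′∈C′ c′∈g′ → only-c (in-C a∉g′ c′∈C′ c′∈g′) c′∈g′) ,
      ∣g′∣≡3

    invariant : Invariant U′ C′ (suc D) x′ b′ t′
    invariant = record
      { chain = chain′ ; x0≡u = x′0≡u ; x∈C = x′∈C′ ; b∉U = b′∉U′ ; b∉C = b′∉C′
      ; U∩C = U′∩C′ ; v∉U = v∉U′ ; v∉C = v∉C′ ; alive-edge = alive-edge′ }

  AliveAt : Subset n → Subset n → Fin n → Subset n → Set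
  AliveAt U C y g = y ∈ g × Alive U C g

  pop : ∀ {U C D x b t} → Invariant U C (suc D) x b t →
        (∀ g → g ∈E H → ¬ AliveAt U C (x (suc D)) g) → Invariant U C D x b t
  pop {U} {C} {D} {x} I none = record
    { chain = Chain-pop chain ; x0≡u = x0≡u ; x∈C = λ i → x∈C i ∘ ℕ.m≤n⇒m≤1+n
    ; b∉U = λ i → b∉U i ∘ ℕ.m<n⇒m<1+n ; b∉C = λ i → b∉C i ∘ ℕ.m<n⇒m<1+n
    ; U∩C = U∩C ; v∉U = v∉U ; v∉C = v∉C ; alive-edge = alive-edge′ }
    where
    open Invariant I
    alive-edge′ : AliveEdgesMeetPath U C D x
    alive-edge′ g g∈H alive c∈C c∈g with alive-edge g g∈H alive c∈C c∈g
    ... | (i , i≤1+D , c≡xi) , only-c , ∣g∣≡3 with ℕ.m≤n⇒m<n∨m≡n i≤1+D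
    ...   | inj₁ i<1+D = (i , ℕ.≤-pred i<1+D , c≡xi) , only-c , ∣g∣≡3
    ...   | inj₂ refl = ⊥-elim (none g g∈H (subst (_∈ g) c≡xi c∈g , alive))

  Strategy : ℕ → Set
  Strategy N = ∀ {U C D x b t} → ∣ U ∣ < N → WaiterWins H U ∅ → Invariant U C D x b t → WaiterWins H U C

  offer-rest-of : ∀ {N} → Strategy N → ∀ {U C D x b t g} → ∣ U ∣ < suc N → WaiterWins H U ∅ →
                  Invariant U C D x b t → g ∈E H → AliveAt U C (x D) g → WaiterWins H U C
  offer-rest-of {N} rec {U} {C} {D} {x} {g = g} ∣U∣<1+N w I g∈H (xD∈g , alive)
    with _ , only-xD , ∣g∣≡3 ← Invariant.alive-edge I g g∈H alive (Invariant.x∈C I D ℕ.≤-refl) xD∈g =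
    offer a₁ a₂ a₁∈U a₂∈U a₁≢a₂ (Client-takes a₁∈g a₁∈U a₂∈U a₁≢a₂ cover)
      (subst (λ V → WaiterWins H V (C ∪ ⁅ a₂ ⁆)) (cong (U ─_) (∪-comm ⁅ a₂ ⁆ ⁅ a₁ ⁆))
        (Client-takes a₂∈g a₂∈U a₁∈U (a₁≢a₂ ∘ sym) (swap ∘ cover)))
    where
    open Triple (∣p∣≡3⇒Triple ∣g∣≡3 xD∈g)
      renaming (other₁ to a₁; other₂ to a₂; other₁≢other₂ to a₁≢a₂; other₁∈g to a₁∈g; other₂∈g to a₂∈g
               ; other₁≢c to a₁≢xD; other₂≢c to a₂≢xD)
    swap : ∀ {z} → z ≡ x D ⊎ z ≡ a₁ ⊎ z ≡ a₂ → z ≡ x D ⊎ z ≡ a₂ ⊎ z ≡ a₁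
    swap = [ inj₁ , [ inj₂ ∘ inj₂ , inj₂ ∘ inj₁ ]′ ]′
    in-U : ∀ {z} → z ∈ g → z ≢ x D → z ∈ U
    in-U z∈g z≢xD =
      [ (λ z∈U → z∈U) , (λ z∈C → contradiction (only-xD z∈C z∈g) z≢xD) ]′ (x∈p∪q⁻ U _ (alive z∈g))
    a₁∈U : a₁ ∈ U
    a₁∈U = in-U a₁∈g a₁≢xD
    a₂∈U : a₂ ∈ U
    a₂∈U = in-U a₂∈g a₂≢xD
    Client-takes : ∀ {c₁ c₂} → c₁ ∈ g → c₁ ∈ U → c₂ ∈ U → c₁ ≢ c₂ →
                   (∀ {z} → z ∈ g → z ≡ x D ⊎ z ≡ c₁ ⊎ z ≡ c₂) →
                   WaiterWins H (U ─ (⁅ c₁ ⁆ ∪ ⁅ c₂ ⁆)) (C ∪ ⁅ c₁ ⁆)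
    Client-takes {c₁} {c₂} c₁∈g c₁∈U c₂∈U c₁≢c₂ cover₁₂ =
      rec fuel (WaiterWins-remove₂ c₁∈U c₂∈U c₁≢c₂ w)
        (Push.invariant I g∈H alive ∣g∣≡3 xD∈g c₁∈g c₁∈U c₂∈U c₁≢c₂ cover₁₂)
      where
      fuel : ∣ U ─ (⁅ c₁ ⁆ ∪ ⁅ c₂ ⁆) ∣ < N
      fuel = ℕ.<⇒≤ (subst (_≤ N) (sym (2+∣p─⁅x⁆∪⁅y⁆∣≡∣p∣ c₁∈U c₂∈U c₁≢c₂)) (ℕ.≤-pred ∣U∣<1+N))

  strategy-step : ∀ {N} → Strategy N → Strategy (suc N)
  strategy-step rec {U} {C} {D} {x} ∣U∣<1+N w I
    with any? (λ g → (x D ∈? g) ×-dec (g ⊆? U ∪ C)) (edges H)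
  ... | yes found with g , g∈H , alive-at ← find found = offer-rest-of rec ∣U∣<1+N w I g∈H alive-at
  strategy-step rec {U} {C} {zero} {x} ∣U∣<1+N w I | no none =
    subst (WaiterWins H U) (∪-identityˡ C) (WaiterWins-∪ avoid w)
    where
    open Invariant I
    alive : ∀ {e} → e ⊆ (U ∪ ∅) ∪ C → Alive U C e
    alive {e} e⊆ = subst (λ S → e ⊆ S ∪ C) (∪-identityʳ U) e⊆
    avoid : EdgesWithinAvoid {G = H} (U ∪ ∅) C
    avoid e e∈H e⊆ z∈e z∈C with alive-edge e e∈H (alive e⊆) z∈C z∈e
    ... | (i , i≤0 , z≡xi) , _ =
      none (lose e∈H (subst (_∈ e) (trans z≡xi (cong x (ℕ.n≤0⇒n≡0 i≤0))) z∈e , alive e⊆))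
  strategy-step rec {D = suc D} ∣U∣<1+N w I | no none =
    strategy-step rec ∣U∣<1+N w (pop I (λ g g∈H alive-at → none (lose g∈H alive-at)))

  -- ∣ U ∣ drops by two with every offer; backtracking recurses on D.
  strategy : ∀ N → Strategy N
  strategy zero ()
  strategy (suc N) = strategy-step (strategy N)

  waiter-wins-with-u-claimed : ∀ {U} → u ∉ U → v ∉ U → WaiterWins H U ∅ → WaiterWins H U ⁅ u ⁆
  waiter-wins-with-u-claimed {U} u∉U v∉U w = strategy (suc ∣ U ∣) ℕ.≤-refl w (initial u∉U v∉U)

waiter-wins-when-Client-takes : ∀ {H : Hypergraph n} {u v} → u ∈ vertices H → v ∈ vertices H → u ≢ v →
  (∀ e → e ∈E H → ∣ e ∣ ≤ 3) → FamilyEmpty (removeVertex H v) u → WaiterWinsGame H →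
  WaiterWins H (vertices H ─ (⁅ u ⁆ ∪ ⁅ v ⁆)) (∅ ∪ ⁅ u ⁆)
waiter-wins-when-Client-takes {H = H} {u} {v} u∈W v∈W u≢v rank≤3 no-family w =
  subst (WaiterWins H _) (sym (∪-identityˡ ⁅ u ⁆))
    (ChainStrategy.waiter-wins-with-u-claimed u≢v rank≤3 no-family
      (taken (∈∪ˡ (x∈⁅x⁆ u))) (taken (∈∪ʳ {p = ⁅ u ⁆} (x∈⁅x⁆ v)))
      (WaiterWins-remove₂ u∈W v∈W u≢v w))
  where
  taken : ∀ {z} → z ∈ ⁅ u ⁆ ∪ ⁅ v ⁆ → z ∉ vertices H ─ (⁅ u ⁆ ∪ ⁅ v ⁆)
  taken z∈uv z∈rest = proj₂ (x∈p─q⁻ (vertices H) _ z∈rest) z∈uv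

mainTheorem15 : ∀ {n} (H : Hypergraph n) (u v : Fin n) →
    WellFormed H → Clutter H → Rank3 H →
    u ∈ vertices H → v ∈ vertices H → u ≢ v →
    FamilyEmpty (removeVertex H v) u →
    FamilyEmpty (removeVertex H u) v →
    WaiterWinsGame H →
    WaiterWinsStartingWith H u v
mainTheorem15 H u v _ _ (rank≤3 , _) u∈W v∈W u≢v no-u-family no-v-family w =
  u∈W , v∈W , u≢v ,
  waiter-wins-when-Client-takes u∈W v∈W u≢v rank≤3 no-u-family w ,
  subst (λ V → WaiterWins H V (∅ ∪ ⁅ v ⁆)) (cong (vertices H ─_) (∪-comm ⁅ v ⁆ ⁅ u ⁆))
    (waiter-wins-when-Client-takes v∈W u∈W (u≢v ∘ sym) rank≤3 no-v-family w)
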